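{- Let $\mathbf Y=\mathbf H(z,\mathbf Y)$, of dimension $m$, be the generating function system of a constructive system. The radius of convergence of its constructible generating function solution is infinite if and only if the system is not recursive and $\mathbf H$ contains neither $\mathrm{Seq}$ nor $\mathrm{Cyc}$ (i.e., neither $1/(1-\cdot)$ nor $\ln(1/(1-\cdot))$).
   Context: A specification is a system $\mathcal Y_i=\mathcal H_i(\mathcal Z,\mathcal Y_1,\dots,\mathcal Y_m)$ of labelled species built from $1$ (single structure of size $0$), $\mathcal Z$ (single atom) and the $\mathcal Y_j$ using disjoint union, labelled product, $\mathrm{Seq}$, $\mathrm{Cyc}$, $\mathrm{Set}$. It is well founded if the iteration $\mathcal Y^{[0]}=0$, $\mathcal Y^{[n+1]}=\mathcal H(\mathcal Z,\mathcal Y^{[n]})$ is well defined for all $n$ (finitely many structures per size; $\mathrm{Seq},\mathrm{Cyc},\mathrm{Set}$ applied only to classes without size-$0$ structures) and converges (structures of each bounded size stabilize); zero-free if some iterate has all coordinates nonempty. A constructive system is a well-founded zero-free specification. Its exponential generating functions satisfy the system obtained by $1\mapsto1$, $\mathcal Z\mapsto z$, $+,\times$ unchanged, $\mathrm{Seq}(G)\mapsto1/(1-G)$, $\mathrm{Cyc}(G)\mapsto\ln(1/(1-G))$, $\mathrm{Set}(G)\mapsto\exp G$; the radius of convergence of the vector solution is the minimum over coordinates. The system is recursive when its dependency graph (vertices $\mathcal Y_i$, edge $\mathcal Y_i\to\mathcal Y_j$ when $\mathcal Y_j$ appears in $\mathcal H_i$) has a cycle, equivalently when the Jacobian matrix $\partial\mathbf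 H/\partial\mathbf Y$ is not nilpotent. -}

module Defs where

open import Data.Nat using (ℕ; zero; suc; _+_; _*_; _∸_; _^_; _!; _/_; _≥_; NonZero)
open import Data.Nat.Properties using (_!≢0)
open import Data.Nat.Combinatorics using (_C_)
open import Data.Fin using (Fin)
open import Data.Product using (Σ; ∃; _×_)
open import Data.Unit using (⊤)
open import Data.Integer using (+_)
import Data.Rational as ℚ
open import Data.Rational using (ℚ)
open import Relation.Binary.PropositionalEquality using (_≡_; _≢_)
open import Relation.Binary.Construct.Closure.Transitive using (TransClosure)
open import Relation.Nullary using (¬_)

data Expr (m : ℕ) : Set where
  one  : Expr m
  atom : Expr m
  var  : Fin m → Expr m
  _⊕_  : Expr m → Expr m → Expr m
  _⊗_  : Expr m → Expr m → Expr m     -- labelled product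
  Seq  : Expr m → Expr m
  Cyc  : Expr m → Expr m
  Set' : Expr m → Expr m

Spec : ℕ → Set
Spec m = Fin m → Expr m

-- Counting sequences of labelled classes: n ↦ number of structures of size n

Counts : Set
Counts = ℕ → ℕ

sumTo : ℕ → (ℕ → ℕ) → ℕ
sumTo zero    f = f 0
sumTo (suc n) f = sumTo n f + f (suc n)

sumToℚ : ℕ → (ℕ → ℚ) → ℚ
sumToℚ zero    f = f 0
sumToℚ (suc n) f = sumToℚ n f ℚ.+ f (suc n)

oneC : Counts
oneC zero    = 1
oneC (suc _) = 0

atomC : Counts
atomC 1 = 1
atomC _ = 0

_⋆_ : Counts → Counts → Counts
(a ⋆ b) n = sumTo n (λ k → (n C k) * (a k * b (n ∸ k)))

pow : Counts → ℕ → Counts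
pow a zero    = oneC
pow a (suc ℓ) = a ⋆ pow a ℓ

-- Seq(A) = Σ_ℓ A^ℓ  (only ℓ ≤ n contribute to size n when A_0 = 0)
seqC : Counts → Counts
seqC a n = sumTo n (λ ℓ → pow a ℓ n)

-- Set(A) = Σ_ℓ A^ℓ / ℓ!   (exact division when A_0 = 0)
setC : Counts → Counts
setC a n = sumTo n (λ ℓ → _/_ (pow a ℓ n) (ℓ !) {{ℓ !≢0}})

-- Cyc(A) = Σ_{ℓ ≥ 1} A^ℓ / ℓ   (exact division when A_0 = 0)
cycC : Counts → Counts
cycC a zero    = 0
cycC a (suc n) = sumTo n (λ ℓ → pow a (suc ℓ) (suc n) / suc ℓ)

eval : ∀ {m} → Expr m → (Fin m → Counts) → Counts
eval one      y = oneC
eval atom     y = atomC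
eval (var j)  y = y j
eval (e ⊕ f)  y = λ n → eval e y n + eval f y n
eval (e ⊗ f)  y = eval e y ⋆ eval f y
eval (Seq e)  y = seqC (eval e y)
eval (Cyc e)  y = cycC (eval e y)
eval (Set' e) y = setC (eval e y)

WellDefinedAt : ∀ {m} → Expr m → (Fin m → Counts) → Set
WellDefinedAt one      y = ⊤
WellDefinedAt atom     y = ⊤
WellDefinedAt (var j)  y = ⊤
WellDefinedAt (e ⊕ f)  y = WellDefinedAt e y × WellDefinedAt f y
WellDefinedAt (e ⊗ f)  y = WellDefinedAt e y × WellDefinedAt f y
WellDefinedAt (Seq e)  y = WellDefinedAt e y × eval e y 0 ≡ 0
WellDefinedAt (Cyc e)  y = WellDefinedAt e y × eval e y 0 ≡ 0
WellDefinedAt (Set' e) y = WellDefinedAt e y × eval e y 0 ≡ 0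

iter : ∀ {m} → Spec m → ℕ → Fin m → Counts
iter H zero    i n = 0
iter H (suc k) i   = eval (H i) (iter H k)

WellFounded : ∀ {m} → Spec m → Set
WellFounded H =
  (∀ k i → WellDefinedAt (H i) (iter H k)) ×
  (∀ i n → ∃ λ N → ∀ k → k ≥ N → iter H k i n ≡ iter H N i n)

ZeroFree : ∀ {m} → Spec m → Set
ZeroFree H = ∃ λ k → ∀ i → ∃ λ n → iter H k i n ≢ 0

Constructive : ∀ {m} → Spec m → Set
Constructive H = WellFounded H × ZeroFree H

-- s is the (constructible) solution: the limit of the iterates
IsLimit : ∀ {m} → Spec m → (Fin m → Counts) → Set
IsLimit H s = ∀ i n → ∃ λ N → ∀ k → k ≥ N → iter H k i n ≡ s i n

data Occurs {m} (j : Fin m) : Expr m → Set where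
  here  : Occurs j (var j)
  ⊕ˡ    : ∀ {e f} → Occurs j e → Occurs j (e ⊕ f)
  ⊕ʳ    : ∀ {e f} → Occurs j f → Occurs j (e ⊕ f)
  ⊗ˡ    : ∀ {e f} → Occurs j e → Occurs j (e ⊗ f)
  ⊗ʳ    : ∀ {e f} → Occurs j f → Occurs j (e ⊗ f)
  inSeq : ∀ {e} → Occurs j e → Occurs j (Seq e)
  inCyc : ∀ {e} → Occurs j e → Occurs j (Cyc e)
  inSet : ∀ {e} → Occurs j e → Occurs j (Set' e)

Edge : ∀ {m} → Spec m → Fin m → Fin m → Set
Edge H i j = Occurs j (H i)

Recursive : ∀ {m} → Spec m → Set
Recursive H = ∃ λ i → TransClosure (Edge H) i i

data HasSeqOrCyc {m} : Expr m → Set where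
  isSeq : ∀ {e} → HasSeqOrCyc (Seq e)
  isCyc : ∀ {e} → HasSeqOrCyc (Cyc e)
  ⊕ˡ    : ∀ {e f} → HasSeqOrCyc e → HasSeqOrCyc (e ⊕ f)
  ⊕ʳ    : ∀ {e f} → HasSeqOrCyc f → HasSeqOrCyc (e ⊕ f)
  ⊗ˡ    : ∀ {e f} → HasSeqOrCyc e → HasSeqOrCyc (e ⊗ f)
  ⊗ʳ    : ∀ {e f} → HasSeqOrCyc f → HasSeqOrCyc (e ⊗ f)
  inSeq : ∀ {e} → HasSeqOrCyc e → HasSeqOrCyc (Seq e)
  inCyc : ∀ {e} → HasSeqOrCyc e → HasSeqOrCyc (Cyc e)
  inSet : ∀ {e} → HasSeqOrCyc e → HasSeqOrCyc (Set' e)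

ContainsSeqOrCyc : ∀ {m} → Spec m → Set
ContainsSeqOrCyc H = ∃ λ i → HasSeqOrCyc (H i)

-- Radius of convergence of the EGF  Σ a_n z^n / n!  is infinite:
-- the series (nonnegative terms) converges at every r ≥ 0, i.e. for every
-- natural r its partial sums Σ_{k ≤ n} a_k r^k / k! are bounded.

egfPartialSum : Counts → ℕ → ℕ → ℚ
egfPartialSum a r n = sumToℚ n (λ k → ℚ._/_ (+ (a k * r ^ k)) (k !) {{k !≢0}})

InfiniteRadius : Counts → Set
InfiniteRadius a = ∀ r → ∃ λ (B : ℕ) → ∀ n → egfPartialSum a r n ℚ.≤ (+ B ℚ./ 1)

-- Call a counting sequence entire when a k r^k ≤ B k! for all r (with B depending on r); this says
-- exactly that its EGF has infinite radius. Entire sequences are closed under +, labelled product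
-- and Set, so when the dependency graph is acyclic (the limit is then reached after m iterations)
-- and neither Seq nor Cyc occurs, the solution is entire.
--
-- Conversely, Seq and Cyc of a nonempty class are never entire: a structure of size d ≥ 1 already
-- gives at least (ℓd)!/(d!)^ℓ labelled sequences of length ℓ. Entireness passes to subexpressions,
-- each being dominated by the whole up to a shift of sizes, so no Seq or Cyc can occur. Finally,
-- on a cycle through Y_i every edge Y_x → Y_y makes Y_x dominate Y_y after a positive shift,
-- strictly at some size, or exactly; composing around the cycle, Y_i dominates itself in one of
-- these ways. An iterated positive shift contradicts entireness, a strict excess is absurd, and
-- exact domination makes the iterates Y^[k] vanish, contradicting zero-freeness.

module Submission where

open import Defs
open import Data.Nat using (ℕ; zero; suc; _+_; _*_; _∸_; _^_; _!; _/_; _%_; _≤_; _<_; z≤n; s≤s; NonZero; >-nonZero; _≟_; _≤?_; _⊔_)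
open import Data.Nat.Properties
open import Data.Nat.DivMod using (m/n*n≡m; m/n*n≤m; m≡m%n+[m/n]*n; m%n<n; n/1≡n; /-congˡ; /-monoˡ-≤)
open import Data.Nat.Combinatorics using (_C_; nCn≡1; nCk≡nC[n∸k]; k![n∸k]!∣n!)
open import Data.Nat.Combinatorics.Specification using (nCk≡n!/k![n-k]!)
open import Data.Nat.Tactic.RingSolver using (solve-∀)
open import Data.Integer using (+≤+) renaming (+_ to pos)
import Data.Integer as ℤ
import Data.Integer.Properties as ℤ
import Data.Rational as ℚ
import Data.Rational.Properties as ℚ
open import Data.Rational.Unnormalised using (mkℚᵘ; *≡*; *≤*)
import Data.Rational.Unnormalised as ℚᵘ
import Data.Rational.Unnormalised.Properties as ℚᵘ
open import Data.Fin using (Fin; toℕ) renaming (zero to fzero; suc to fsuc)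
import Data.Fin.Properties as Fin
open import Data.Product using (Σ; ∃; _×_; _,_; proj₁; proj₂)
open import Data.Sum using (inj₁; inj₂)
open import Data.Empty using (⊥; ⊥-elim)
open import Data.Unit using (tt)
open import Function.Bundles using (_⇔_; mk⇔)
open import Relation.Nullary using (¬_; Dec; yes; no)
open import Relation.Nullary.Negation using (¬¬-Monad; ¬¬-map)
open import Relation.Nullary.Decidable using (¬¬-excluded-middle)
open import Effect.Monad using (RawMonad)
open import Level using (0ℓ)
open import Function.Base using (_∘_; id)
open import Relation.Binary.PropositionalEquality using (_≡_; refl; sym; trans; cong; cong₂; subst; subst₂)
open import Relation.Binary.Construct.Closure.Transitive using (TransClosure; [_]; _∷_; _∷ʳ_)
open ≤-Reasoning

sumTo-mono-≤ : ∀ n {f g : ℕ → ℕ} → (∀ k → k ≤ n → f k ≤ g k) → sumTo n f ≤ sumTo n g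
sumTo-mono-≤ zero    f≤g = f≤g 0 z≤n
sumTo-mono-≤ (suc n) f≤g =
  +-mono-≤ (sumTo-mono-≤ n (λ k k≤n → f≤g k (m≤n⇒m≤1+n k≤n))) (f≤g (suc n) ≤-refl)

sumTo-cong : ∀ n {f g : ℕ → ℕ} → (∀ k → k ≤ n → f k ≡ g k) → sumTo n f ≡ sumTo n g
sumTo-cong zero    f≡g = f≡g 0 z≤n
sumTo-cong (suc n) f≡g =
  cong₂ _+_ (sumTo-cong n (λ k k≤n → f≡g k (m≤n⇒m≤1+n k≤n))) (f≡g (suc n) ≤-refl)

term≤sumTo : ∀ n (f : ℕ → ℕ) {k} → k ≤ n → f k ≤ sumTo n f
term≤sumTo zero    f z≤n = ≤-refl
term≤sumTo (suc n) f k≤1+n with m≤n⇒m<n∨m≡n k≤1+n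
... | inj₁ k<1+n = ≤-trans (term≤sumTo n f (≤-pred k<1+n)) (m≤m+n _ _)
... | inj₂ refl  = m≤n+m _ _

sumTo≤[1+n]*bound : ∀ n {f : ℕ → ℕ} X → (∀ k → k ≤ n → f k ≤ X) → sumTo n f ≤ suc n * X
sumTo≤[1+n]*bound zero    X f≤X = ≤-trans (f≤X 0 z≤n) (≤-reflexive (sym (+-identityʳ X)))
sumTo≤[1+n]*bound (suc n) X f≤X = begin
  sumTo n _ + _  ≤⟨ +-mono-≤ (sumTo≤[1+n]*bound n X (λ k k≤n → f≤X k (m≤n⇒m≤1+n k≤n))) (f≤X (suc n) ≤-refl) ⟩
  suc n * X + X  ≡⟨ +-comm (suc n * X) X ⟩
  suc (suc n) * X ∎

sumTo-*ʳ : ∀ n (f : ℕ → ℕ) c → sumTo n f * c ≡ sumTo n (λ k → f k * c)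
sumTo-*ʳ zero    f c = refl
sumTo-*ʳ (suc n) f c =
  trans (*-distribʳ-+ c (sumTo n f) (f (suc n))) (cong (_+ f (suc n) * c) (sumTo-*ʳ n f c))

sumTo-zero : ∀ n (f : ℕ → ℕ) → (∀ k → k ≤ n → f k ≡ 0) → sumTo n f ≡ 0
sumTo-zero n f f≡0 = trans (sumTo-cong n f≡0) (sumTo-const0 n)
  where
  sumTo-const0 : ∀ n → sumTo n (λ _ → 0) ≡ 0
  sumTo-const0 zero    = refl
  sumTo-const0 (suc n) = cong (_+ 0) (sumTo-const0 n)

sumTo-last : ∀ n (f : ℕ → ℕ) → (∀ k → k < n → f k ≡ 0) → sumTo n f ≡ f n
sumTo-last zero    f _   = refl
sumTo-last (suc n) f f≡0 = cong (_+ f (suc n)) (sumTo-zero n f (λ k k≤n → f≡0 k (s≤s k≤n)))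

sumTo-unfoldˡ : ∀ n (f : ℕ → ℕ) → sumTo (suc n) f ≡ f 0 + sumTo n (λ k → f (suc k))
sumTo-unfoldˡ zero    f = refl
sumTo-unfoldˡ (suc n) f =
  trans (cong (_+ f (suc (suc n))) (sumTo-unfoldˡ n f)) (+-assoc (f 0) _ (f (suc (suc n))))

sumTo-reverse : ∀ n (f : ℕ → ℕ) → sumTo n (λ k → f (n ∸ k)) ≡ sumTo n f
sumTo-reverse zero    f = refl
sumTo-reverse (suc n) f = begin-equality
  sumTo n (λ k → f (suc n ∸ k)) + f (suc n ∸ suc n)   ≡⟨ cong₂ _+_ (sumTo-cong n (λ k k≤n → cong f (+-∸-assoc 1 k≤n)))
                                                                 (cong f (n∸n≡0 n)) ⟩
  sumTo n (λ k → f (suc (n ∸ k))) + f 0               ≡⟨ cong (_+ f 0) (sumTo-reverse n (λ k → f (suc k))) ⟩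
  sumTo n (λ k → f (suc k)) + f 0                     ≡⟨ +-comm _ (f 0) ⟩
  f 0 + sumTo n (λ k → f (suc k))                     ≡⟨ sym (sumTo-unfoldˡ n f) ⟩
  sumTo (suc n) f                                     ∎

sumTo≤halving : ∀ n (f : ℕ → ℕ) X → f 0 ≡ 0 → (∀ k → 1 ≤ k → k ≤ n → f k * 2 ^ k ≤ X) →
                sumTo n f ≤ X
sumTo≤halving n f X f0≡0 f≤X/2^k =
  *-cancelʳ-≤ (sumTo n f) X (2 ^ n) {{m^n≢0 2 n}} (≤-trans (m≤m+n _ X) (scaled n f≤X/2^k))
  where
  scaled : ∀ n → (∀ k → 1 ≤ k → k ≤ n → f k * 2 ^ k ≤ X) → sumTo n f * 2 ^ n + X ≤ X * 2 ^ n
  scaled zero    _     rewrite f0≡0 = ≤-reflexive (sym (*-identityʳ X))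
  scaled (suc n) bound = begin
    (S + f (suc n)) * (2 * 2 ^ n) + X           ≡⟨ cong (_+ X) (*-distribʳ-+ (2 * 2 ^ n) S (f (suc n))) ⟩
    S * (2 * 2 ^ n) + f (suc n) * (2 * 2 ^ n) + X ≤⟨ +-monoˡ-≤ X (+-monoʳ-≤ (S * (2 * 2 ^ n)) (bound (suc n) (s≤s z≤n) ≤-refl)) ⟩
    S * (2 * 2 ^ n) + X + X                     ≡⟨ regroup S X (2 ^ n) ⟩
    2 * (S * 2 ^ n + X)                         ≤⟨ *-monoʳ-≤ 2 (scaled n (λ k 1≤k k≤n → bound k 1≤k (m≤n⇒m≤1+n k≤n))) ⟩
    2 * (X * 2 ^ n)                             ≡⟨ x*[y*z]≡y*[x*z] 2 X (2 ^ n) ⟩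
    X * (2 * 2 ^ n)                             ∎
    where
    S : ℕ
    S = sumTo n f
    regroup : ∀ S X p → S * (2 * p) + X + X ≡ 2 * (S * p + X)
    regroup = solve-∀
    x*[y*z]≡y*[x*z] : ∀ x y z → x * (y * z) ≡ y * (x * z)
    x*[y*z]≡y*[x*z] = solve-∀

nCk*[k!*[n∸k]!]≡n! : ∀ {n k} → k ≤ n → (n C k) * (k ! * (n ∸ k) !) ≡ n !
nCk*[k!*[n∸k]!]≡n! {n} {k} k≤n =
  trans (cong (_* (k ! * (n ∸ k) !)) (nCk≡n!/k![n-k]! k≤n)) (m/n*n≡m (k![n∸k]!∣n! k≤n))
  where instance _ = k !* (n ∸ k) !≢0

^-distribʳ-* : ∀ m n k → (m * n) ^ k ≡ m ^ k * n ^ k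
^-distribʳ-* m n zero    = refl
^-distribʳ-* m n (suc k) = trans (cong (m * n *_) (^-distribʳ-* m n k)) (interchange m n (m ^ k) (n ^ k))
  where
  interchange : ∀ m n a b → m * n * (a * b) ≡ m * a * (n * b)
  interchange = solve-∀

n<2^n : ∀ n → n < 2 ^ n
n<2^n zero    = s≤s z≤n
n<2^n (suc n) = begin-strict
  suc n          <⟨ s≤s (n<2^n n) ⟩
  suc (2 ^ n)    ≤⟨ +-monoˡ-≤ (2 ^ n) (m^n>0 2 n) ⟩
  2 ^ n + 2 ^ n  ≡⟨ cong (2 ^ n +_) (sym (+-identityʳ (2 ^ n))) ⟩
  2 * 2 ^ n      ∎

1≤n^n : ∀ n → 1 ≤ n ^ n
1≤n^n zero    = ≤-refl
1≤n^n (suc n) = m^n>0 (suc n) (suc n)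

m^n≤m^m*n! : ∀ m n → m ^ n ≤ m ^ m * n !
m^n≤m^m*n! m zero = ≤-trans (1≤n^n m) (≤-reflexive (sym (*-identityʳ _)))
m^n≤m^m*n! m (suc n) with suc n ≤? m
... | yes 1+n≤m = begin
  m ^ suc n      ≤⟨ ^-monoʳ-≤ m {{>-nonZero (≤-trans (s≤s z≤n) 1+n≤m)}} 1+n≤m ⟩
  m ^ m          ≤⟨ m≤m*n (m ^ m) (suc n !) {{>-nonZero (1≤n! (suc n))}} ⟩
  m ^ m * suc n ! ∎
... | no 1+n≰m = begin
  m * m ^ n           ≤⟨ *-mono-≤ (<⇒≤ (≰⇒> 1+n≰m)) (m^n≤m^m*n! m n) ⟩
  suc n * (m ^ m * n !) ≡⟨ x*[y*z]≡y*[x*z] (suc n) (m ^ m) (n !) ⟩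
  m ^ m * suc n !     ∎
  where
  x*[y*z]≡y*[x*z] : ∀ x y z → x * (y * z) ≡ y * (x * z)
  x*[y*z]≡y*[x*z] = solve-∀

infix 4 _≤ᶜ_

_≤ᶜ_ : Counts → Counts → Set
a ≤ᶜ b = ∀ n → a n ≤ b n

≤ᶜ-trans : ∀ {a b c} → a ≤ᶜ b → b ≤ᶜ c → a ≤ᶜ c
≤ᶜ-trans a≤b b≤c n = ≤-trans (a≤b n) (b≤c n)

AgreeUpTo : ℕ → Counts → Counts → Set
AgreeUpTo n a b = ∀ k → k ≤ n → a k ≡ b k

Nonempty : Counts → Set
Nonempty a = ∃ λ n → 1 ≤ a n

⋆-congUpTo : ∀ n {a a′ b b′} → AgreeUpTo n a a′ → AgreeUpTo n b b′ → AgreeUpTo n (a ⋆ b) (a′ ⋆ b′)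
⋆-congUpTo n a≡a′ b≡b′ k k≤n = sumTo-cong k (λ i i≤k →
  cong ((k C i) *_) (cong₂ _*_ (a≡a′ i (≤-trans i≤k k≤n)) (b≡b′ (k ∸ i) (≤-trans (m∸n≤m k i) k≤n))))

pow-congUpTo : ∀ n {a a′} → AgreeUpTo n a a′ → ∀ ℓ → AgreeUpTo n (pow a ℓ) (pow a′ ℓ)
pow-congUpTo n a≡a′ zero    k _ = refl
pow-congUpTo n a≡a′ (suc ℓ)     = ⋆-congUpTo n a≡a′ (pow-congUpTo n a≡a′ ℓ)

eval-congUpTo : ∀ {m} n (e : Expr m) {y y′ : Fin m → Counts} →
                (∀ j → Occurs j e → AgreeUpTo n (y j) (y′ j)) → AgreeUpTo n (eval e y) (eval e y′)
eval-congUpTo n one      _   _ _ = refl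
eval-congUpTo n atom     _   _ _ = refl
eval-congUpTo n (var j)  y≡y′    = y≡y′ j here
eval-congUpTo n (e ⊕ f)  y≡y′ k k≤n =
  cong₂ _+_ (eval-congUpTo n e (λ j o → y≡y′ j (⊕ˡ o)) k k≤n) (eval-congUpTo n f (λ j o → y≡y′ j (⊕ʳ o)) k k≤n)
eval-congUpTo n (e ⊗ f)  y≡y′ =
  ⋆-congUpTo n (eval-congUpTo n e (λ j o → y≡y′ j (⊗ˡ o))) (eval-congUpTo n f (λ j o → y≡y′ j (⊗ʳ o)))
eval-congUpTo n (Seq e)  y≡y′ k k≤n =
  sumTo-cong k (λ ℓ _ → pow-congUpTo n (eval-congUpTo n e (λ j o → y≡y′ j (inSeq o))) ℓ k k≤n)
eval-congUpTo n (Cyc e)  y≡y′ zero    _   = refl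
eval-congUpTo n (Cyc e)  y≡y′ (suc k) k≤n =
  sumTo-cong k (λ ℓ _ → /-congˡ (pow-congUpTo n (eval-congUpTo n e (λ j o → y≡y′ j (inCyc o))) (suc ℓ) (suc k) k≤n))
eval-congUpTo n (Set' e) y≡y′ k k≤n =
  sumTo-cong k (λ ℓ _ → /-congˡ {{ℓ !≢0}} (pow-congUpTo n (eval-congUpTo n e (λ j o → y≡y′ j (inSet o))) ℓ k k≤n))

sizeZero-cong : ∀ {m} (e : Expr m) {y y′ : Fin m → Counts} → (∀ j → y j 0 ≡ y′ j 0) →
                eval e y 0 ≡ 0 → eval e y′ 0 ≡ 0
sizeZero-cong e y≡y′ = trans (sym (eval-congUpTo 0 e (λ { j _ .zero z≤n → y≡y′ j }) 0 z≤n))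

wellDefinedAt-cong : ∀ {m} (e : Expr m) {y y′ : Fin m → Counts} → (∀ j → y j 0 ≡ y′ j 0) →
                     WellDefinedAt e y → WellDefinedAt e y′
wellDefinedAt-cong one      _    _          = tt
wellDefinedAt-cong atom     _    _          = tt
wellDefinedAt-cong (var j)  _    _          = tt
wellDefinedAt-cong (e ⊕ f)  y≡y′ (we , wf)  = wellDefinedAt-cong e y≡y′ we , wellDefinedAt-cong f y≡y′ wf
wellDefinedAt-cong (e ⊗ f)  y≡y′ (we , wf)  = wellDefinedAt-cong e y≡y′ we , wellDefinedAt-cong f y≡y′ wf
wellDefinedAt-cong (Seq e)  y≡y′ (we , e₀) = wellDefinedAt-cong e y≡y′ we , sizeZero-cong e y≡y′ e₀
wellDefinedAt-cong (Cyc e)  y≡y′ (we , e₀) = wellDefinedAt-cong e y≡y′ we , sizeZero-cong e y≡y′ e₀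
wellDefinedAt-cong (Set' e) y≡y′ (we , e₀) = wellDefinedAt-cong e y≡y′ we , sizeZero-cong e y≡y′ e₀

⋆-mono : ∀ {a a′ b b′} → a ≤ᶜ a′ → b ≤ᶜ b′ → a ⋆ b ≤ᶜ a′ ⋆ b′
⋆-mono a≤a′ b≤b′ n = sumTo-mono-≤ n (λ k _ → *-monoʳ-≤ (n C k) (*-mono-≤ (a≤a′ k) (b≤b′ (n ∸ k))))

pow-mono : ∀ {a a′} → a ≤ᶜ a′ → ∀ ℓ → pow a ℓ ≤ᶜ pow a′ ℓ
pow-mono a≤a′ zero    n = ≤-refl
pow-mono a≤a′ (suc ℓ)   = ⋆-mono a≤a′ (pow-mono a≤a′ ℓ)

eval-mono : ∀ {m} (e : Expr m) {y y′ : Fin m → Counts} → (∀ j → y j ≤ᶜ y′ j) → eval e y ≤ᶜ eval e y′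
eval-mono one      _    n       = ≤-refl
eval-mono atom     _    n       = ≤-refl
eval-mono (var j)  y≤y′         = y≤y′ j
eval-mono (e ⊕ f)  y≤y′ n       = +-mono-≤ (eval-mono e y≤y′ n) (eval-mono f y≤y′ n)
eval-mono (e ⊗ f)  y≤y′         = ⋆-mono (eval-mono e y≤y′) (eval-mono f y≤y′)
eval-mono (Seq e)  y≤y′ n       = sumTo-mono-≤ n (λ ℓ _ → pow-mono (eval-mono e y≤y′) ℓ n)
eval-mono (Cyc e)  y≤y′ zero    = ≤-refl
eval-mono (Cyc e)  y≤y′ (suc n) =
  sumTo-mono-≤ n (λ ℓ _ → /-monoˡ-≤ (suc ℓ) (pow-mono (eval-mono e y≤y′) (suc ℓ) (suc n)))
eval-mono (Set' e) y≤y′ n       =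
  sumTo-mono-≤ n (λ ℓ _ → /-monoˡ-≤ (ℓ !) {{ℓ !≢0}} (pow-mono (eval-mono e y≤y′) ℓ n))

⋆-term : ∀ {a b : Counts} n {k} → k ≤ n → (n C k) * (a k * b (n ∸ k)) ≤ (a ⋆ b) n
⋆-term {a} {b} n = term≤sumTo n (λ k → (n C k) * (a k * b (n ∸ k)))

≤pow1 : ∀ (a : Counts) → a ≤ᶜ pow a 1
≤pow1 a n = ≤-trans (≤-reflexive (sym diagonal)) (⋆-term {a} {oneC} n ≤-refl)
  where
  diagonal : (n C n) * (a n * oneC (n ∸ n)) ≡ a n
  diagonal rewrite nCn≡1 n | n∸n≡0 n = trans (+-identityʳ _) (*-identityʳ (a n))

≤setC : ∀ (a : Counts) → a 0 ≡ 0 → a ≤ᶜ setC a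
≤setC a a₀≡0 zero    rewrite a₀≡0 = z≤n
≤setC a a₀≡0 (suc n) = ≤-trans (≤pow1 a (suc n)) (≤-trans (≤-reflexive (sym (n/1≡n _)))
  (term≤sumTo (suc n) (λ ℓ → (pow a ℓ (suc n) / ℓ !) {{ℓ !≢0}}) (s≤s z≤n)))

≤cycC : ∀ (a : Counts) → a 0 ≡ 0 → a ≤ᶜ cycC a
≤cycC a a₀≡0 zero    rewrite a₀≡0 = z≤n
≤cycC a a₀≡0 (suc n) = ≤-trans (≤pow1 a (suc n)) (≤-trans (≤-reflexive (sym (n/1≡n _)))
  (term≤sumTo n (λ ℓ → pow a (suc ℓ) (suc n) / suc ℓ) z≤n))

⋆-comm : ∀ (a b : Counts) n → (a ⋆ b) n ≡ (b ⋆ a) n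
⋆-comm a b n = begin-equality
  sumTo n (λ k → (n C k) * (a k * b (n ∸ k)))
    ≡⟨ sym (sumTo-reverse n _) ⟩
  sumTo n (λ k → (n C (n ∸ k)) * (a (n ∸ k) * b (n ∸ (n ∸ k))))
    ≡⟨ sumTo-cong n (λ k k≤n → cong₂ (λ c i → c * (a (n ∸ k) * b i)) (sym (nCk≡nC[n∸k] k≤n)) (m∸[m∸n]≡n k≤n)) ⟩
  sumTo n (λ k → (n C k) * (a (n ∸ k) * b k))
    ≡⟨ sumTo-cong n (λ k _ → cong ((n C k) *_) (*-comm (a (n ∸ k)) (b k))) ⟩
  sumTo n (λ k → (n C k) * (b k * a (n ∸ k))) ∎

binomial-split : ∀ i j → ((i + j) C i) * (i ! * j !) ≡ (i + j) !
binomial-split i j =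
  subst (λ t → ((i + j) C i) * (i ! * t !) ≡ (i + j) !) (m+n∸m≡n i j) (nCk*[k!*[n∸k]!]≡n! (m≤m+n i j))

⋆-term-split : ∀ (a b : Counts) i j → ((i + j) C i) * (a i * b j) ≤ (a ⋆ b) (i + j)
⋆-term-split a b i j =
  subst (λ t → ((i + j) C i) * (a i * b t) ≤ (a ⋆ b) (i + j)) (m+n∸m≡n i j) (⋆-term {a} {b} (i + j) (m≤m+n i j))

⋆-egf-term : ∀ (a b : Counts) i j → a i * b j * (i + j) ! ≤ (a ⋆ b) (i + j) * (i ! * j !)
⋆-egf-term a b i j = begin
  a i * b j * (i + j) !                  ≡⟨ cong (a i * b j *_) (sym (binomial-split i j)) ⟩
  a i * b j * (((i + j) C i) * (i ! * j !)) ≡⟨ reassoc (a i) (b j) ((i + j) C i) (i ! * j !) ⟩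
  ((i + j) C i) * (a i * b j) * (i ! * j !) ≤⟨ *-monoˡ-≤ (i ! * j !) (⋆-term-split a b i j) ⟩
  (a ⋆ b) (i + j) * (i ! * j !)          ∎
  where
  reassoc : ∀ x y c f → x * y * (c * f) ≡ c * (x * y) * f
  reassoc = solve-∀

ConcentratedAt0 : Counts → Set
ConcentratedAt0 a = ∀ q → 1 ≤ q → a q ≡ 0

⋆-concentratedʳ : ∀ (a b : Counts) → ConcentratedAt0 b → ∀ n → (a ⋆ b) n ≡ a n * b 0
⋆-concentratedʳ a b b₊≡0 n = trans
  (sumTo-last n _ (λ k k<n → trans (cong (λ t → (n C k) * (a k * t)) (b₊≡0 (n ∸ k) (m<n⇒0<n∸m k<n)))
                               (trans (cong ((n C k) *_) (*-zeroʳ (a k))) (*-zeroʳ (n C k)))))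
  (trans (cong₂ (λ c t → c * (a n * b t)) (nCn≡1 n) (n∸n≡0 n)) (+-identityʳ _))

-- Entire counting sequences

Entire : Counts → Set
Entire a = ∀ r → ∃ λ B → ∀ k → a k * r ^ k ≤ B * k !

Entire-resp-≗ : ∀ {a b} → (∀ n → a n ≡ b n) → Entire b → Entire a
Entire-resp-≗ {a} a≗b eb r with eb r
... | B , bound = B , λ k → subst (λ t → t * r ^ k ≤ B * k !) (sym (a≗b k)) (bound k)

≤ᶜ-entire : ∀ {a b} → a ≤ᶜ b → Entire b → Entire a
≤ᶜ-entire {a} {b} a≤b eb r with eb r
... | B , b≤B = B , λ k → ≤-trans (*-monoˡ-≤ (r ^ k) (a≤b k)) (b≤B k)

-- Doubling the radius buys a factor 2^n, which absorbs the polynomial losses below.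
halveRadius : ∀ x ρ n c → x * (2 * ρ) ^ n ≤ 2 ^ n * c → x * ρ ^ n ≤ c
halveRadius x ρ n c x[2ρ]^n≤ = *-cancelʳ-≤ (x * ρ ^ n) c (2 ^ n) {{m^n≢0 2 n}} (begin
  x * ρ ^ n * 2 ^ n    ≡⟨ reorder x (ρ ^ n) (2 ^ n) ⟩
  x * (2 ^ n * ρ ^ n)  ≡⟨ cong (x *_) (sym (^-distribʳ-* 2 ρ n)) ⟩
  x * (2 * ρ) ^ n      ≤⟨ x[2ρ]^n≤ ⟩
  2 ^ n * c            ≡⟨ *-comm (2 ^ n) c ⟩
  c * 2 ^ n            ∎)
  where
  reorder : ∀ x p q → x * p * q ≡ x * (q * p)
  reorder = solve-∀

⋆-bound : ∀ ρ (a b F G : Counts) → (∀ k → a k * ρ ^ k ≤ F k * k !) → (∀ k → b k * ρ ^ k ≤ G k * k !) →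
          ∀ n → (a ⋆ b) n * ρ ^ n ≤ sumTo n (λ k → F k * G (n ∸ k)) * n !
⋆-bound ρ a b F G a≤F b≤G n = begin
  sumTo n (λ k → (n C k) * (a k * b (n ∸ k))) * ρ ^ n  ≡⟨ sumTo-*ʳ n _ (ρ ^ n) ⟩
  sumTo n (λ k → (n C k) * (a k * b (n ∸ k)) * ρ ^ n)  ≤⟨ sumTo-mono-≤ n term ⟩
  sumTo n (λ k → F k * G (n ∸ k) * n !)               ≡⟨ sym (sumTo-*ʳ n _ (n !)) ⟩
  sumTo n (λ k → F k * G (n ∸ k)) * n !               ∎
  where
  split : ∀ c x y p q → c * (x * y) * (p * q) ≡ c * ((x * p) * (y * q))
  split = solve-∀
  gather : ∀ c f g u v → c * ((f * u) * (g * v)) ≡ f * g * (c * (u * v))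
  gather = solve-∀
  term : ∀ k → k ≤ n → (n C k) * (a k * b (n ∸ k)) * ρ ^ n ≤ F k * G (n ∸ k) * n !
  term k k≤n = begin
    (n C k) * (a k * b (n ∸ k)) * ρ ^ n
      ≡⟨ cong (λ t → (n C k) * (a k * b (n ∸ k)) * ρ ^ t) (sym (m+[n∸m]≡n k≤n)) ⟩
    (n C k) * (a k * b (n ∸ k)) * ρ ^ (k + (n ∸ k))
      ≡⟨ cong ((n C k) * (a k * b (n ∸ k)) *_) (^-distribˡ-+-* ρ k (n ∸ k)) ⟩
    (n C k) * (a k * b (n ∸ k)) * (ρ ^ k * ρ ^ (n ∸ k))
      ≡⟨ split (n C k) (a k) (b (n ∸ k)) (ρ ^ k) (ρ ^ (n ∸ k)) ⟩
    (n C k) * ((a k * ρ ^ k) * (b (n ∸ k) * ρ ^ (n ∸ k)))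
      ≤⟨ *-monoʳ-≤ (n C k) (*-mono-≤ (a≤F k) (b≤G (n ∸ k))) ⟩
    (n C k) * ((F k * k !) * (G (n ∸ k) * (n ∸ k) !))
      ≡⟨ gather (n C k) (F k) (G (n ∸ k)) (k !) ((n ∸ k) !) ⟩
    F k * G (n ∸ k) * ((n C k) * (k ! * (n ∸ k) !))
      ≡⟨ cong (F k * G (n ∸ k) *_) (nCk*[k!*[n∸k]!]≡n! k≤n) ⟩
    F k * G (n ∸ k) * n ! ∎

Entire-oneC : Entire oneC
Entire-oneC r = 1 , λ { zero → ≤-refl ; (suc k) → z≤n }

Entire-atomC : Entire atomC
Entire-atomC r = r , λ { zero → z≤n ; (suc zero) → ≤-reflexive (r*1≡r*1*1 r) ; (suc (suc k)) → z≤n }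
  where
  r*1≡r*1*1 : ∀ r → 1 * (r * 1) ≡ r * (1 * 1)
  r*1≡r*1*1 = solve-∀

Entire-+ : ∀ {a b} → Entire a → Entire b → Entire (λ n → a n + b n)
Entire-+ {a} {b} ea eb r with ea r | eb r
... | A , a≤A | B , b≤B = A + B , λ k → begin
  (a k + b k) * r ^ k         ≡⟨ *-distribʳ-+ (r ^ k) (a k) (b k) ⟩
  a k * r ^ k + b k * r ^ k   ≤⟨ +-mono-≤ (a≤A k) (b≤B k) ⟩
  A * k ! + B * k !           ≡⟨ sym (*-distribʳ-+ (k !) A B) ⟩
  (A + B) * k !               ∎

Entire-⋆ : ∀ {a b} → Entire a → Entire b → Entire (a ⋆ b)
Entire-⋆ {a} {b} ea eb r with ea (2 * r) | eb (2 * r)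
... | A , a≤A | B , b≤B = A * B , λ n → halveRadius ((a ⋆ b) n) r n (A * B * n !) (begin
  (a ⋆ b) n * (2 * r) ^ n      ≤⟨ ⋆-bound (2 * r) a b (λ _ → A) (λ _ → B) a≤A b≤B n ⟩
  sumTo n (λ _ → A * B) * n !  ≤⟨ *-monoˡ-≤ (n !) (sumTo≤[1+n]*bound n (A * B) (λ _ _ → ≤-refl)) ⟩
  suc n * (A * B) * n !        ≤⟨ *-monoˡ-≤ (n !) (*-monoˡ-≤ (A * B) (n<2^n n)) ⟩
  2 ^ n * (A * B) * n !        ≡⟨ *-assoc (2 ^ n) (A * B) (n !) ⟩
  2 ^ n * (A * B * n !)        ∎)

-- Since a 0 = 0, the factor A of a size-k piece is paid for by 2^k, so the ℓ-th power costs
-- only A^ℓ 2^n instead of a sum over all compositions of n.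
pow-bound : ∀ ρ (a : Counts) A → a 0 ≡ 0 → (∀ k → a k * ρ ^ k ≤ A * k !) →
            ∀ ℓ n → pow a ℓ n * ρ ^ n ≤ A ^ ℓ * 2 ^ n * n !
pow-bound ρ a A a₀≡0 a≤A zero    zero    = ≤-refl
pow-bound ρ a A a₀≡0 a≤A zero    (suc n) = z≤n
pow-bound ρ a A a₀≡0 a≤A (suc ℓ) n       = begin
  (a ⋆ pow a ℓ) n * ρ ^ n
    ≤⟨ ⋆-bound ρ a (pow a ℓ) A₊ (λ j → A ^ ℓ * 2 ^ j) a≤A₊ (pow-bound ρ a A a₀≡0 a≤A ℓ) n ⟩
  sumTo n (λ k → A₊ k * (A ^ ℓ * 2 ^ (n ∸ k))) * n !
    ≤⟨ *-monoˡ-≤ (n !) (sumTo≤halving n _ (A * A ^ ℓ * 2 ^ n) refl term) ⟩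
  A * A ^ ℓ * 2 ^ n * n ! ∎
  where
  A₊ : Counts
  A₊ zero    = 0
  A₊ (suc _) = A
  a≤A₊ : ∀ k → a k * ρ ^ k ≤ A₊ k * k !
  a≤A₊ zero    rewrite a₀≡0 = z≤n
  a≤A₊ (suc k) = a≤A (suc k)
  reassoc : ∀ A P x y → A * (P * x) * y ≡ A * P * (x * y)
  reassoc = solve-∀
  term : ∀ k → 1 ≤ k → k ≤ n → A₊ k * (A ^ ℓ * 2 ^ (n ∸ k)) * 2 ^ k ≤ A * A ^ ℓ * 2 ^ n
  term (suc k) _ k<n = ≤-reflexive (begin-equality
    A * (A ^ ℓ * 2 ^ (n ∸ suc k)) * 2 ^ suc k  ≡⟨ reassoc A (A ^ ℓ) (2 ^ (n ∸ suc k)) (2 ^ suc k) ⟩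
    A * A ^ ℓ * (2 ^ (n ∸ suc k) * 2 ^ suc k)  ≡⟨ cong (A * A ^ ℓ *_) (sym (^-distribˡ-+-* 2 (n ∸ suc k) (suc k))) ⟩
    A * A ^ ℓ * 2 ^ (n ∸ suc k + suc k)        ≡⟨ cong (λ t → A * A ^ ℓ * 2 ^ t) (m∸n+n≡m k<n) ⟩
    A * A ^ ℓ * 2 ^ n                          ∎)

Entire-setC : ∀ {a} → Entire a → a 0 ≡ 0 → Entire (setC a)
Entire-setC {a} ea a₀≡0 r with ea (2 * (2 * r))
... | A , a≤A = A ^ A , λ n → halveRadius (setC a n) r n (A ^ A * n !) (begin
  setC a n * (2 * r) ^ n                                   ≡⟨ sumTo-*ʳ n _ ((2 * r) ^ n) ⟩
  sumTo n (λ ℓ → (pow a ℓ n / ℓ !) {{ℓ !≢0}} * (2 * r) ^ n) ≤⟨ sumTo≤[1+n]*bound n (A ^ A * n !) (λ ℓ _ → term n ℓ) ⟩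
  suc n * (A ^ A * n !)                                    ≤⟨ *-monoˡ-≤ (A ^ A * n !) (n<2^n n) ⟩
  2 ^ n * (A ^ A * n !)                                    ∎)
  where
  swap₂₃ : ∀ p q s → p * q * s ≡ p * s * q
  swap₂₃ = solve-∀
  pow≤ : ∀ n ℓ → pow a ℓ n * (2 * r) ^ n ≤ A ^ ℓ * n !
  pow≤ n ℓ = halveRadius (pow a ℓ n) (2 * r) n (A ^ ℓ * n !)
    (≤-trans (pow-bound (2 * (2 * r)) a A a₀≡0 a≤A ℓ n) (≤-reflexive (reorder (A ^ ℓ) (2 ^ n) (n !))))
    where
    reorder : ∀ p q s → p * q * s ≡ q * (p * s)
    reorder = solve-∀
  term : ∀ n ℓ → (pow a ℓ n / ℓ !) {{ℓ !≢0}} * (2 * r) ^ n ≤ A ^ A * n !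
  term n ℓ = *-cancelʳ-≤ _ _ (ℓ !) (begin
    pow a ℓ n / ℓ ! * (2 * r) ^ n * ℓ !  ≡⟨ swap₂₃ (pow a ℓ n / ℓ !) ((2 * r) ^ n) (ℓ !) ⟩
    pow a ℓ n / ℓ ! * ℓ ! * (2 * r) ^ n  ≤⟨ *-monoˡ-≤ ((2 * r) ^ n) (m/n*n≤m (pow a ℓ n) (ℓ !)) ⟩
    pow a ℓ n * (2 * r) ^ n              ≤⟨ pow≤ n ℓ ⟩
    A ^ ℓ * n !                          ≤⟨ *-monoˡ-≤ (n !) (m^n≤m^m*n! A ℓ) ⟩
    A ^ A * ℓ ! * n !                    ≡⟨ swap₂₃ (A ^ A) (ℓ !) (n !) ⟩
    A ^ A * n ! * ℓ !                    ∎)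
    where instance _ = ℓ !≢0

eval-entire : ∀ {m} (e : Expr m) (y : Fin m → Counts) → ¬ HasSeqOrCyc e → WellDefinedAt e y →
              (∀ j → Entire (y j)) → Entire (eval e y)
eval-entire one      y _   _          _  = Entire-oneC
eval-entire atom     y _   _          _  = Entire-atomC
eval-entire (var j)  y _   _          ey = ey j
eval-entire (e ⊕ f)  y ¬sc (we , wf)  ey =
  Entire-+ {eval e y} {eval f y} (eval-entire e y (¬sc ∘ ⊕ˡ) we ey) (eval-entire f y (¬sc ∘ ⊕ʳ) wf ey)
eval-entire (e ⊗ f)  y ¬sc (we , wf)  ey =
  Entire-⋆ {eval e y} {eval f y} (eval-entire e y (¬sc ∘ ⊗ˡ) we ey) (eval-entire f y (¬sc ∘ ⊗ʳ) wf ey)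
eval-entire (Seq e)  y ¬sc _          _  = ⊥-elim (¬sc isSeq)
eval-entire (Cyc e)  y ¬sc _          _  = ⊥-elim (¬sc isCyc)
eval-entire (Set' e) y ¬sc (we , e₀)  ey = Entire-setC (eval-entire e y (¬sc ∘ inSet) we ey) e₀

-- Entire sequences are exactly those with infinite radius

x*s≤y*q⇒x/q≤y/s : ∀ x q y s .{{_ : NonZero q}} .{{_ : NonZero s}} →
                  x * s ≤ y * q → pos x ℚ./ q ℚ.≤ pos y ℚ./ s
x*s≤y*q⇒x/q≤y/s x (suc q) y (suc s) x*s≤y*q = ℚ.toℚᵘ-cancel-≤
  (ℚᵘ.≤-respˡ-≃ (ℚᵘ.≃-sym (ℚ.toℚᵘ-fromℚᵘ (mkℚᵘ (pos x) q)))
  (ℚᵘ.≤-respʳ-≃ (ℚᵘ.≃-sym (ℚ.toℚᵘ-fromℚᵘ (mkℚᵘ (pos y) s)))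
  (*≤* (subst₂ ℤ._≤_ (ℤ.pos-* x (suc s)) (ℤ.pos-* y (suc q)) (+≤+ x*s≤y*q)))))

x/q≤y/s⇒x*s≤y*q : ∀ x q y s .{{_ : NonZero q}} .{{_ : NonZero s}} →
                  pos x ℚ./ q ℚ.≤ pos y ℚ./ s → x * s ≤ y * q
x/q≤y/s⇒x*s≤y*q x (suc q) y (suc s) x/q≤y/s
  with ℚᵘ.≤-respˡ-≃ (ℚ.toℚᵘ-fromℚᵘ (mkℚᵘ (pos x) q))
         (ℚᵘ.≤-respʳ-≃ (ℚ.toℚᵘ-fromℚᵘ (mkℚᵘ (pos y) s)) (ℚ.toℚᵘ-mono-≤ x/q≤y/s))
... | *≤* xs≤yq = ℤ.drop‿+≤+ (subst₂ ℤ._≤_ (sym (ℤ.pos-* x (suc s))) (sym (ℤ.pos-* y (suc q))) xs≤yq)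

x*s≡y*q⇒x/q≡y/s : ∀ x q y s .{{_ : NonZero q}} .{{_ : NonZero s}} →
                  x * s ≡ y * q → pos x ℚ./ q ≡ pos y ℚ./ s
x*s≡y*q⇒x/q≡y/s x (suc q) y (suc s) x*s≡y*q = ℚ.fromℚᵘ-cong {mkℚᵘ (pos x) q} {mkℚᵘ (pos y) s}
  (*≡* (trans (sym (ℤ.pos-* x (suc s))) (trans (cong pos x*s≡y*q) (ℤ.pos-* y (suc q)))))

x/q+y/s≡[x*s+y*q]/[q*s] : ∀ x q y s .{{_ : NonZero q}} .{{_ : NonZero s}} →
  pos x ℚ./ q ℚ.+ pos y ℚ./ s ≡ (pos (x * s + y * q) ℚ./ (q * s)) {{m*n≢0 q s}}
x/q+y/s≡[x*s+y*q]/[q*s] x (suc q) y (suc s) = ℚ.toℚᵘ-injective (ℚᵘ.≃-trans (ℚ.toℚᵘ-homo-+ (pos x ℚ./ suc q) (pos y ℚ./ suc s))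
  (ℚᵘ.≃-trans (ℚᵘ.+-cong (ℚ.toℚᵘ-fromℚᵘ (mkℚᵘ (pos x) q)) (ℚ.toℚᵘ-fromℚᵘ (mkℚᵘ (pos y) s)))
  (ℚᵘ.≃-trans (ℚᵘ.≃-reflexive sumᵘ) (ℚᵘ.≃-sym (ℚ.toℚᵘ-fromℚᵘ _)))))
  where
  sumᵘ : mkℚᵘ (pos x) q ℚᵘ.+ mkℚᵘ (pos y) s ≡ mkℚᵘ (pos (x * suc s + y * suc q)) (s + q * suc s)
  sumᵘ = cong (λ t → mkℚᵘ t (s + q * suc s))
    (trans (cong₂ ℤ._+_ (sym (ℤ.pos-* x (suc s))) (sym (ℤ.pos-* y (suc q)))) (sym (ℤ.pos-+ (x * suc s) (y * suc q))))

-- Σ_{k ≤ n} x k * n! / k!, the numerator of Σ_{k ≤ n} x k / k! over the denominator n!.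
numerator : (ℕ → ℕ) → ℕ → ℕ
numerator x zero    = x 0
numerator x (suc n) = numerator x n * suc n + x (suc n)

sumToℚ≡numerator/n! : ∀ (x : ℕ → ℕ) n →
  sumToℚ n (λ k → (pos (x k) ℚ./ k !) {{k !≢0}}) ≡ (pos (numerator x n) ℚ./ n !) {{n !≢0}}
sumToℚ≡numerator/n! x zero    = refl
sumToℚ≡numerator/n! x (suc n) =
  trans (cong (ℚ._+ pos (x (suc n)) ℚ./ suc n !) (sumToℚ≡numerator/n! x n))
  (trans (x/q+y/s≡[x*s+y*q]/[q*s] T (n !) (x (suc n)) (suc n !))
         (x*s≡y*q⇒x/q≡y/s (T * suc n ! + x (suc n) * n !) (n ! * suc n !) (numerator x (suc n)) (suc n !)
            {{m*n≢0 (n !) (suc n !)}} (cancel-n! T (x (suc n)) n (n !))))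
  where
  instance _ = n !≢0
  instance _ = suc n !≢0
  T : ℕ
  T = numerator x n
  cancel-n! : ∀ T x n f → (T * ((1 + n) * f) + x * f) * ((1 + n) * f) ≡ (T * (1 + n) + x) * (f * ((1 + n) * f))
  cancel-n! = solve-∀

x≤numerator : ∀ x n → x n ≤ numerator x n
x≤numerator x zero    = ≤-refl
x≤numerator x (suc n) = m≤n+m _ _

-- Induction invariant: the extra A n! on the left is what makes the step from n to n+1 close.
numerator-bound : ∀ (x : ℕ → ℕ) A → (∀ k → x k * 2 ^ k ≤ A * k !) →
                  ∀ n → numerator x n * 2 ^ n + A * n ! ≤ 2 * A * n ! * 2 ^ n
numerator-bound x A x≤A zero = begin
  x 0 * 1 + A * 1  ≤⟨ +-monoˡ-≤ (A * 1) (x≤A 0) ⟩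
  A * 1 + A * 1    ≡⟨ double A ⟩
  2 * A * 1 * 1    ∎
  where
  double : ∀ A → A * 1 + A * 1 ≡ 2 * A * 1 * 1
  double = solve-∀
numerator-bound x A x≤A (suc n) = begin
  (T * suc n + x (suc n)) * (2 * 2 ^ n) + A * (suc n * n !)
    ≡⟨ expand T n (x (suc n)) (2 ^ n) A (n !) ⟩
  2 * suc n * (T * 2 ^ n) + x (suc n) * (2 * 2 ^ n) + A * (suc n * n !)
    ≤⟨ +-monoˡ-≤ (A * (suc n * n !)) (+-monoʳ-≤ (2 * suc n * (T * 2 ^ n)) (x≤A (suc n))) ⟩
  2 * suc n * (T * 2 ^ n) + A * (suc n * n !) + A * (suc n * n !)
    ≡⟨ collect T n (2 ^ n) A (n !) ⟩
  2 * suc n * (T * 2 ^ n + A * n !)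
    ≤⟨ *-monoʳ-≤ (2 * suc n) (numerator-bound x A x≤A n) ⟩
  2 * suc n * (2 * A * n ! * 2 ^ n)
    ≡⟨ reorder n A (n !) (2 ^ n) ⟩
  2 * A * (suc n * n !) * (2 * 2 ^ n) ∎
  where
  T : ℕ
  T = numerator x n
  expand : ∀ T n x p A f → (T * (1 + n) + x) * (2 * p) + A * ((1 + n) * f) ≡
                           2 * (1 + n) * (T * p) + x * (2 * p) + A * ((1 + n) * f)
  expand = solve-∀
  collect : ∀ T n p A f → 2 * (1 + n) * (T * p) + A * ((1 + n) * f) + A * ((1 + n) * f) ≡
                          2 * (1 + n) * (T * p + A * f)
  collect = solve-∀
  reorder : ∀ n A f p → 2 * (1 + n) * (2 * A * f * p) ≡ 2 * A * ((1 + n) * f) * (2 * p)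
  reorder = solve-∀

egfPartialSum≡numerator/n! : ∀ a r n →
  egfPartialSum a r n ≡ (pos (numerator (λ k → a k * r ^ k) n) ℚ./ n !) {{n !≢0}}
egfPartialSum≡numerator/n! a r = sumToℚ≡numerator/n! (λ k → a k * r ^ k)

infiniteRadius⇒entire : ∀ a → InfiniteRadius a → Entire a
infiniteRadius⇒entire a ir r with ir r
... | B , partialSum≤B = B , λ n → begin
  x n                ≤⟨ x≤numerator x n ⟩
  numerator x n      ≡⟨ sym (*-identityʳ _) ⟩
  numerator x n * 1  ≤⟨ x/q≤y/s⇒x*s≤y*q (numerator x n) (n !) B 1 {{n !≢0}}
                          (subst (ℚ._≤ pos B ℚ./ 1) (egfPartialSum≡numerator/n! a r n) (partialSum≤B n)) ⟩
  B * n !            ∎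
  where
  x : ℕ → ℕ
  x k = a k * r ^ k

entire⇒infiniteRadius : ∀ a → Entire a → InfiniteRadius a
entire⇒infiniteRadius a ea r with ea (2 * r)
... | A , a≤A = 2 * A , λ n → subst (ℚ._≤ pos (2 * A) ℚ./ 1) (sym (egfPartialSum≡numerator/n! a r n))
  (x*s≤y*q⇒x/q≤y/s (numerator x n) (n !) (2 * A) 1 {{n !≢0}}
    (≤-trans (≤-reflexive (*-identityʳ _)) (numerator≤ n)))
  where
  x : ℕ → ℕ
  x k = a k * r ^ k
  x*2^k≤A*k! : ∀ k → x k * 2 ^ k ≤ A * k !
  x*2^k≤A*k! k = ≤-trans (≤-reflexive (begin-equality
    a k * r ^ k * 2 ^ k    ≡⟨ *-assoc (a k) (r ^ k) (2 ^ k) ⟩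
    a k * (r ^ k * 2 ^ k)  ≡⟨ cong (a k *_) (*-comm (r ^ k) (2 ^ k)) ⟩
    a k * (2 ^ k * r ^ k)  ≡⟨ cong (a k *_) (sym (^-distribʳ-* 2 r k)) ⟩
    a k * (2 * r) ^ k      ∎)) (a≤A k)
  numerator≤ : ∀ n → numerator x n ≤ 2 * A * n !
  numerator≤ n = *-cancelʳ-≤ _ _ (2 ^ n) {{m^n≢0 2 n}}
    (≤-trans (m≤m+n _ (A * n !)) (numerator-bound x A x*2^k≤A*k! n))

-- Iterates, the limit, and stabilisation of non-recursive systems

Eventually : (ℕ → Set) → Set
Eventually P = ∃ λ N → ∀ k → N ≤ k → P k

eventually-× : ∀ {P Q : ℕ → Set} → Eventually P → Eventually Q → Eventually (λ k → P k × Q k)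
eventually-× (N , p) (M , q) = N ⊔ M , λ k N⊔M≤k →
  p k (≤-trans (m≤m⊔n N M) N⊔M≤k) , q k (≤-trans (m≤n⊔m N M) N⊔M≤k)

eventually-∀Fin : ∀ {m} {P : Fin m → ℕ → Set} → (∀ j → Eventually (P j)) → Eventually (λ k → ∀ j → P j k)
eventually-∀Fin {zero}          _  = 0 , λ _ _ ()
eventually-∀Fin {suc m} {P} ev with eventually-× (ev fzero) (eventually-∀Fin {P = λ j → P (fsuc j)} (λ j → ev (fsuc j)))
... | N , p = N , λ { k N≤k fzero → proj₁ (p k N≤k) ; k N≤k (fsuc j) → proj₂ (p k N≤k) j }

eventually-∀≤ : ∀ n {P : ℕ → ℕ → Set} → (∀ i → i ≤ n → Eventually (P i)) →
                Eventually (λ k → ∀ i → i ≤ n → P i k)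
eventually-∀≤ zero    ev with ev 0 z≤n
... | N , p = N , λ { k N≤k .zero z≤n → p k N≤k }
eventually-∀≤ (suc n) {P} ev with eventually-× (ev (suc n) ≤-refl) (eventually-∀≤ n {P} (λ i i≤n → ev i (m≤n⇒m≤1+n i≤n)))
... | N , p = N , λ k N≤k i i≤1+n → at i i≤1+n (p k N≤k)
  where
  at : ∀ {k} i → i ≤ suc n → P (suc n) k × (∀ i → i ≤ n → P i k) → P i k
  at i i≤1+n (p₁ , p≤n) with m≤n⇒m<n∨m≡n i≤1+n
  ... | inj₁ i<1+n = p≤n i (≤-pred i<1+n)
  ... | inj₂ refl  = p₁

module Walks {m : ℕ} (H : Spec m) where

  Walk : ℕ → Fin m → Set
  Walk k i = Σ (ℕ → Fin m) λ w → w 0 ≡ i × (∀ t → t < k → Edge H (w t) (w (suc t)))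

  ¬walk-step : ∀ {k i j} → ¬ Walk (suc k) i → Edge H i j → ¬ Walk k j
  ¬walk-step {k} {i} ¬walk i→j (w , w₀≡j , steps) = ¬walk (i ◃ w , refl , steps′)
    where
    _◃_ : Fin m → (ℕ → Fin m) → ℕ → Fin m
    (i ◃ w) zero    = i
    (i ◃ w) (suc t) = w t
    steps′ : ∀ t → t < suc k → Edge H ((i ◃ w) t) ((i ◃ w) (suc t))
    steps′ zero    _     = subst (Edge H i) (sym w₀≡j) i→j
    steps′ (suc t) t<1+k = steps t (≤-pred t<1+k)

  walk-segment : ∀ (w : ℕ → Fin m) K → (∀ t → t < K → Edge H (w t) (w (suc t))) →
                 ∀ a b → a < b → b ≤ K → TransClosure (Edge H) (w a) (w b)
  walk-segment w K steps a (suc b) a<1+b 1+b≤K with m≤n⇒m<n∨m≡n (≤-pred a<1+b)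
  ... | inj₁ a<b  = walk-segment w K steps a b a<b (≤-trans (n≤1+n b) 1+b≤K) ∷ʳ steps b 1+b≤K
  ... | inj₂ refl = [ steps a 1+b≤K ]

  walk⇒recursive : ∀ {i} → Walk m i → Recursive H
  walk⇒recursive (w , _ , steps) with Fin.pigeonhole (n<1+n m) (λ t → w (toℕ t))
  ... | a , b , a<b , wa≡wb = w (toℕ a) , subst (TransClosure (Edge H) (w (toℕ a))) (sym wa≡wb)
    (walk-segment w m steps (toℕ a) (toℕ b) a<b (≤-pred (Fin.toℕ<n b)))

  -- iter H k i only sees the vertices reachable from i by walks of length < k.
  ¬walk⇒iter-stable : ∀ k i → ¬ Walk k i → ∀ n → iter H (suc k) i n ≡ iter H k i n
  ¬walk⇒iter-stable zero    i ¬walk n = ⊥-elim (¬walk ((λ _ → i) , refl , λ _ ()))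
  ¬walk⇒iter-stable (suc k) i ¬walk n = eval-congUpTo n (H i)
    (λ j i→j n′ _ → ¬walk⇒iter-stable k j (¬walk-step ¬walk i→j) n′) n ≤-refl

  nonRecursive⇒iter-stable : ¬ Recursive H → ∀ k i → m ≤ k → ∀ n → iter H k i n ≡ iter H m i n
  nonRecursive⇒iter-stable ¬rec zero    i z≤n   n = refl
  nonRecursive⇒iter-stable ¬rec (suc k) i m≤1+k n with m≤n⇒m<n∨m≡n m≤1+k
  ... | inj₂ refl = refl
  ... | inj₁ m<1+k = trans (¬walk⇒iter-stable k i ¬walk n) (nonRecursive⇒iter-stable ¬rec k i (≤-pred m<1+k) n)
    where
    ¬walk : ¬ Walk k i
    ¬walk (w , w₀≡i , steps) = ¬rec (walk⇒recursive (w , w₀≡i , λ t t<m → steps t (≤-trans t<m (≤-pred m<1+k))))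

module Limit {m : ℕ} (H : Spec m) (s : Fin m → Counts) (lim : IsLimit H s) where

  iter-step : ∀ k i → iter H k i ≤ᶜ iter H (suc k) i
  iter-step zero    i n = z≤n
  iter-step (suc k) i   = eval-mono (H i) (iter-step k)

  iter-mono : ∀ {k k′} → k ≤ k′ → ∀ i → iter H k i ≤ᶜ iter H k′ i
  iter-mono {k} {zero}   z≤n   i n = ≤-refl
  iter-mono {k} {suc k′} k≤1+k′ i n with m≤n⇒m<n∨m≡n k≤1+k′
  ... | inj₁ k<1+k′ = ≤-trans (iter-mono (≤-pred k<1+k′) i n) (iter-step k′ i n)
  ... | inj₂ refl   = ≤-refl

  iter≤limit : ∀ k i → iter H k i ≤ᶜ s i
  iter≤limit k i n with lim i n
  ... | N , conv = ≤-trans (iter-mono (m≤m⊔n k N) i n) (≤-reflexive (conv (k ⊔ N) (m≤n⊔m k N)))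

  agreeEventually : ∀ n → Eventually (λ k → ∀ j → AgreeUpTo n (iter H k j) (s j))
  agreeEventually n = eventually-∀Fin (λ j → eventually-∀≤ n (λ n′ _ → lim j n′))

  limit-isFixpoint : ∀ i n → s i n ≡ eval (H i) s n
  limit-isFixpoint i n with agreeEventually n
  ... | N , agree = trans (sym (agree (suc N) (n≤1+n N) i n ≤-refl))
                          (eval-congUpTo n (H i) (λ j _ → agree N ≤-refl j) n ≤-refl)

  limit-wellDefined : WellFounded H → ∀ i → WellDefinedAt (H i) s
  limit-wellDefined (wd , _) i with agreeEventually 0
  ... | N , agree = wellDefinedAt-cong (H i) (λ j → agree N ≤-refl j 0 z≤n) (wd N i)

  nonRecursive⇒limit≡iter : ¬ Recursive H → ∀ i n → s i n ≡ iter H m i n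
  nonRecursive⇒limit≡iter ¬rec i n with lim i n
  ... | N , conv = trans (sym (conv (N ⊔ m) (m≤m⊔n N m)))
                         (Walks.nonRecursive⇒iter-stable H ¬rec (N ⊔ m) i (m≤n⊔m N m) n)

iter-entire : ∀ {m} (H : Spec m) → WellFounded H → ¬ ContainsSeqOrCyc H → ∀ k i → Entire (iter H k i)
iter-entire H _        _   zero    i r = 0 , λ _ → z≤n
iter-entire H wf       ¬sc (suc k) i   =
  eval-entire (H i) (iter H k) (λ sc → ¬sc (i , sc)) (proj₁ wf k i) (iter-entire H wf ¬sc k)

nonRecursive⇒limit-entire : ∀ {m} (H : Spec m) → WellFounded H → (s : Fin m → Counts) → IsLimit H s →
                            ¬ Recursive H → ¬ ContainsSeqOrCyc H → ∀ i → Entire (s i)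
nonRecursive⇒limit-entire {m} H wf s lim ¬rec ¬sc i =
  Entire-resp-≗ (Limit.nonRecursive⇒limit≡iter H s lim ¬rec i) (iter-entire H wf ¬sc m i)

-- Shifted domination

record Shift≤ (d K : ℕ) (a b : Counts) : Set where
  constructor shift≤
  field atSize : ∀ n → a n * (n + d) ! ≤ K * (b (n + d) * n !)
open Shift≤

≤ᶜ⇒Shift≤ : ∀ {a b} → a ≤ᶜ b → Shift≤ 0 1 a b
≤ᶜ⇒Shift≤ {a} {b} a≤b = shift≤ bound
  where
  bound : ∀ n → a n * (n + 0) ! ≤ 1 * (b (n + 0) * n !)
  bound n rewrite +-identityʳ n = ≤-trans (*-monoˡ-≤ (n !) (a≤b n)) (≤-reflexive (sym (*-identityˡ _)))

Shift≤-trans : ∀ {d K d′ K′ a b c} → Shift≤ d K a b → Shift≤ d′ K′ b c → Shift≤ (d + d′) (K * K′) a c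
Shift≤-trans {d} {K} {d′} {K′} {a} {b} {c} a≤b b≤c = shift≤ λ n → *-cancelʳ-≤ _ _ ((n + d) !) {{(n + d) !≢0}} (begin
  a n * (n + (d + d′)) ! * (n + d) !                ≡⟨ cong (λ t → a n * t ! * (n + d) !) (sym (+-assoc n d d′)) ⟩
  a n * (n + d + d′) ! * (n + d) !                  ≡⟨ swap₂₃ (a n) ((n + d + d′) !) ((n + d) !) ⟩
  a n * (n + d) ! * (n + d + d′) !                  ≤⟨ *-monoˡ-≤ ((n + d + d′) !) (atSize a≤b n) ⟩
  K * (b (n + d) * n !) * (n + d + d′) !            ≡⟨ regroup K (b (n + d)) (n !) ((n + d + d′) !) ⟩
  K * n ! * (b (n + d) * (n + d + d′) !)            ≤⟨ *-monoʳ-≤ (K * n !) (atSize b≤c (n + d)) ⟩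
  K * n ! * (K′ * (c (n + d + d′) * (n + d) !))     ≡⟨ cong (λ t → K * n ! * (K′ * (c t * (n + d) !))) (+-assoc n d d′) ⟩
  K * n ! * (K′ * (c (n + (d + d′)) * (n + d) !))   ≡⟨ collect K (n !) K′ (c (n + (d + d′))) ((n + d) !) ⟩
  K * K′ * (c (n + (d + d′)) * n !) * (n + d) !     ∎)
  where
  swap₂₃ : ∀ a x y → a * x * y ≡ a * y * x
  swap₂₃ = solve-∀
  regroup : ∀ K b f x → K * (b * f) * x ≡ K * f * (b * x)
  regroup = solve-∀
  collect : ∀ K f K′ c g → K * f * (K′ * (c * g)) ≡ K * K′ * (c * f) * g
  collect = solve-∀

Shift≤-respʳ : ∀ {d K a b b′} → (∀ n → b n ≡ b′ n) → Shift≤ d K a b → Shift≤ d K a b′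
Shift≤-respʳ {d} {K} {a} b≗b′ a≤b = shift≤ λ n →
  subst (λ t → a n * (n + d) ! ≤ K * (t * n !)) (b≗b′ (n + d)) (atSize a≤b n)

Shift≤-iterate : ∀ {d K a} → Shift≤ d K a a → ∀ ℓ → Shift≤ (ℓ * d) (K ^ ℓ) a a
Shift≤-iterate {a = a} a≤a zero    = ≤ᶜ⇒Shift≤ {a} {a} (λ _ → ≤-refl)
Shift≤-iterate          a≤a (suc ℓ) = Shift≤-trans a≤a (Shift≤-iterate a≤a ℓ)

Shift≤-entire : ∀ {d K a b} → Shift≤ d K a b → Entire b → Entire a
Shift≤-entire {d} {K} {a} {b} a≤b eb r with eb (suc r)
... | B , b≤B = K * B , λ n → ≤-trans (*-monoʳ-≤ (a n) (^-monoˡ-≤ n (n≤1+n r))) (bound n)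
  where
  r′ : ℕ
  r′ = suc r
  regroup₁ : ∀ a x y f → a * x * y * f ≡ a * f * (x * y)
  regroup₁ = solve-∀
  regroup₂ : ∀ K b f x → K * (b * f) * x ≡ K * f * (b * x)
  regroup₂ = solve-∀
  regroup₃ : ∀ K f B g → K * f * (B * g) ≡ K * B * f * g
  regroup₃ = solve-∀
  bound : ∀ n → a n * r′ ^ n ≤ K * B * n !
  bound n = ≤-trans (m≤m*n (a n * r′ ^ n) (r′ ^ d) {{m^n≢0 r′ d}})
    (*-cancelʳ-≤ _ _ ((n + d) !) {{(n + d) !≢0}} (begin
    a n * r′ ^ n * r′ ^ d * (n + d) !      ≡⟨ regroup₁ (a n) (r′ ^ n) (r′ ^ d) ((n + d) !) ⟩
    a n * (n + d) ! * (r′ ^ n * r′ ^ d)    ≡⟨ cong (a n * (n + d) ! *_) (sym (^-distribˡ-+-* r′ n d)) ⟩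
    a n * (n + d) ! * r′ ^ (n + d)         ≤⟨ *-monoˡ-≤ (r′ ^ (n + d)) (atSize a≤b n) ⟩
    K * (b (n + d) * n !) * r′ ^ (n + d)   ≡⟨ regroup₂ K (b (n + d)) (n !) (r′ ^ (n + d)) ⟩
    K * n ! * (b (n + d) * r′ ^ (n + d))   ≤⟨ *-monoʳ-≤ (K * n !) (b≤B (n + d)) ⟩
    K * n ! * (B * (n + d) !)              ≡⟨ regroup₃ K (n !) B ((n + d) !) ⟩
    K * B * n ! * (n + d) !                ∎))

Shift≤-nonempty : ∀ {d K a b} → Shift≤ d K a b → Nonempty a → Nonempty b
Shift≤-nonempty {d} {K} {a} {b} a≤b (n , 1≤aₙ) with b (n + d) ≟ 0
... | no  bₙ₊d≢0 = n + d , n≢0⇒n>0 bₙ₊d≢0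
... | yes bₙ₊d≡0 = ⊥-elim (<-irrefl refl (<-≤-trans (*-mono-≤ 1≤aₙ (1≤n! (n + d)))
    (≤-trans (atSize a≤b n) (≤-reflexive (trans (cong (λ t → K * (t * n !)) bₙ₊d≡0) (*-zeroʳ K))))))

Shift≤-at-radius : ∀ {d K} {a : Counts} n₀ r B → 1 ≤ a n₀ → a n₀ * (n₀ + d) ! ≤ K * (a (n₀ + d) * n₀ !) →
                   (∀ k → a k * r ^ k ≤ B * k !) → r ^ (n₀ + d) ≤ K * (n₀ ! * B)
Shift≤-at-radius {d} {K} {a} n₀ r B 1≤aₙ₀ a≤a a≤B = *-cancelˡ-≤ (N !) {{N !≢0}} (begin
  N ! * r ^ N                 ≤⟨ *-monoˡ-≤ (r ^ N) (≤-trans (≤-reflexive (sym (*-identityˡ (N !)))) (*-monoˡ-≤ (N !) 1≤aₙ₀)) ⟩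
  a n₀ * N ! * r ^ N          ≤⟨ *-monoˡ-≤ (r ^ N) a≤a ⟩
  K * (a N * n₀ !) * r ^ N    ≡⟨ regroup₁ K (a N) (n₀ !) (r ^ N) ⟩
  K * n₀ ! * (a N * r ^ N)    ≤⟨ *-monoʳ-≤ (K * n₀ !) (a≤B N) ⟩
  K * n₀ ! * (B * N !)        ≡⟨ regroup₂ K (n₀ !) B (N !) ⟩
  N ! * (K * (n₀ ! * B))      ∎)
  where
  N : ℕ
  N = n₀ + d
  regroup₁ : ∀ k a f q → k * (a * f) * q ≡ k * f * (a * q)
  regroup₁ = solve-∀
  regroup₂ : ∀ k f b g → k * f * (b * g) ≡ g * (k * (f * b))
  regroup₂ = solve-∀

-- Iterating the self-domination ℓ times moves mass ℓ·d sizes up at cost only K^ℓ, which an entire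
-- bound at radius 2(K + 1) cannot afford once ℓ = n₀! · B.
Shift≤-self⇒¬entire : ∀ {d K a} → Shift≤ d K a a → 1 ≤ d → Nonempty a → ¬ Entire a
Shift≤-self⇒¬entire {d} {K} {a} a≤a 1≤d (n₀ , 1≤aₙ₀) ea with ea (2 * suc K)
... | B , a≤B = <-irrefl refl (<-≤-trans (n<2^n ℓ) 2^ℓ≤ℓ)
  where
  ℓ : ℕ
  ℓ = n₀ ! * B
  ℓ≤ℓ*d : ℓ ≤ n₀ + ℓ * d
  ℓ≤ℓ*d = ≤-trans (m≤m*n ℓ d {{>-nonZero 1≤d}}) (m≤n+m (ℓ * d) n₀)
  2^ℓ≤ℓ : 2 ^ ℓ ≤ ℓ
  2^ℓ≤ℓ = *-cancelʳ-≤ _ _ (suc K ^ ℓ) {{m^n≢0 (suc K) ℓ}} (begin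
    2 ^ ℓ * suc K ^ ℓ        ≡⟨ sym (^-distribʳ-* 2 (suc K) ℓ) ⟩
    (2 * suc K) ^ ℓ          ≤⟨ ^-monoʳ-≤ (2 * suc K) ℓ≤ℓ*d ⟩
    (2 * suc K) ^ (n₀ + ℓ * d) ≤⟨ Shift≤-at-radius {ℓ * d} {K ^ ℓ} {a} n₀ (2 * suc K) B 1≤aₙ₀ (atSize (Shift≤-iterate a≤a ℓ) n₀) a≤B ⟩
    K ^ ℓ * ℓ                ≤⟨ *-monoˡ-≤ ℓ (^-monoˡ-≤ ℓ (n≤1+n K)) ⟩
    suc K ^ ℓ * ℓ            ≡⟨ *-comm (suc K ^ ℓ) ℓ ⟩
    ℓ * suc K ^ ℓ            ∎)

⋆-Shift≤ˡ : ∀ {a b : Counts} q → 1 ≤ b q → Shift≤ q (q !) a (a ⋆ b)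
⋆-Shift≤ˡ {a} {b} q 1≤b_q = shift≤ λ n → begin
  a n * (n + q) !                ≤⟨ *-monoˡ-≤ ((n + q) !) (≤-trans (≤-reflexive (sym (*-identityʳ (a n)))) (*-monoʳ-≤ (a n) 1≤b_q)) ⟩
  a n * b q * (n + q) !          ≤⟨ ⋆-egf-term a b n q ⟩
  (a ⋆ b) (n + q) * (n ! * q !)  ≡⟨ reorder ((a ⋆ b) (n + q)) (n !) (q !) ⟩
  q ! * ((a ⋆ b) (n + q) * n !)  ∎
  where
  reorder : ∀ c f g → c * (f * g) ≡ g * (c * f)
  reorder = solve-∀

eval-nonempty : ∀ {m} (e : Expr m) (y : Fin m → Counts) → (∀ j → Nonempty (y j)) → WellDefinedAt e y →
                Nonempty (eval e y)
eval-nonempty one      y _  _         = 0 , ≤-refl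
eval-nonempty atom     y _  _         = 1 , ≤-refl
eval-nonempty (var j)  y ne _         = ne j
eval-nonempty (e ⊕ f)  y ne (we , _)  with eval-nonempty e y ne we
... | n , 1≤eₙ = n , ≤-trans 1≤eₙ (m≤m+n _ _)
eval-nonempty (e ⊗ f)  y ne (we , wf) with eval-nonempty f y ne wf
... | q , 1≤f_q = Shift≤-nonempty (⋆-Shift≤ˡ {eval e y} {eval f y} q 1≤f_q) (eval-nonempty e y ne we)
eval-nonempty (Seq e)  y _  _         = 0 , ≤-refl
eval-nonempty (Cyc e)  y ne (we , e₀) with eval-nonempty e y ne we
... | n , 1≤eₙ = n , ≤-trans 1≤eₙ (≤cycC (eval e y) e₀ n)
eval-nonempty (Set' e) y _  _         = 0 , ≤-refl

-- Sequences and cycles are never entire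

pow-lowerBound : ∀ (a : Counts) d → 1 ≤ a d → ∀ ℓ → (ℓ * d) ! ≤ pow a ℓ (ℓ * d) * (d !) ^ ℓ
pow-lowerBound a d 1≤a_d zero    = ≤-refl
pow-lowerBound a d 1≤a_d (suc ℓ) = begin
  (d + ℓ * d) !                       ≡⟨ sym (binomial-split d (ℓ * d)) ⟩
  c * (d ! * (ℓ * d) !)               ≤⟨ *-monoʳ-≤ c (*-monoʳ-≤ (d !) (pow-lowerBound a d 1≤a_d ℓ)) ⟩
  c * (d ! * (P * (d !) ^ ℓ))         ≡⟨ reassoc c (d !) P ((d !) ^ ℓ) ⟩
  c * (1 * P) * (d ! * (d !) ^ ℓ)     ≤⟨ *-monoˡ-≤ (d ! * (d !) ^ ℓ) (*-monoʳ-≤ c (*-monoˡ-≤ P 1≤a_d)) ⟩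
  c * (a d * P) * (d ! * (d !) ^ ℓ)   ≤⟨ *-monoˡ-≤ (d ! * (d !) ^ ℓ) (⋆-term-split a (pow a ℓ) d (ℓ * d)) ⟩
  pow a (suc ℓ) (d + ℓ * d) * (d ! * (d !) ^ ℓ) ∎
  where
  c : ℕ
  c = (d + ℓ * d) C d
  P : ℕ
  P = pow a ℓ (ℓ * d)
  reassoc : ∀ c f p g → c * (f * (p * g)) ≡ c * (1 * p) * (f * g)
  reassoc = solve-∀

-- A class with a structure of size d ≥ 1 has at least (ℓd)!/(d!)^ℓ ordered ℓ-tuples of total size ℓd,
-- far more than an entire u allows once u (ℓd) still controls them up to a factor ℓ.
powers≤⇒¬entire : ∀ (a u : Counts) d → 1 ≤ d → 1 ≤ a d →
                  (∀ ℓ → 1 ≤ ℓ → pow a ℓ (ℓ * d) ≤ (u (ℓ * d) + 1) * ℓ) → ¬ Entire u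
powers≤⇒¬entire a u d 1≤d 1≤a_d pow≤u eu with eu (4 * d !)
... | B , u≤B = <-irrefl refl (begin-strict
  ℓ * ℓ          <⟨ *-mono-< (n<2^n ℓ) (n<2^n ℓ) ⟩
  2 ^ ℓ * 2 ^ ℓ  ≡⟨ sym (^-distribʳ-* 2 2 ℓ) ⟩
  4 ^ ℓ          ≤⟨ *-cancelˡ-≤ (X !) {{X !≢0}} (≤-trans lower upper) ⟩
  ℓ * M          ≤⟨ *-monoʳ-≤ ℓ (n≤1+n M) ⟩
  ℓ * ℓ          ∎)
  where
  r : ℕ
  r = 4 * d !
  M : ℕ
  M = B + r ^ r
  ℓ : ℕ
  ℓ = suc M
  X : ℕ
  X = ℓ * d
  r^ℓ≤r^X : r ^ ℓ ≤ r ^ X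
  r^ℓ≤r^X = ^-monoʳ-≤ r {{>-nonZero (*-mono-≤ (s≤s (z≤n {3})) (1≤n! d))}} (m≤m*n ℓ d {{>-nonZero 1≤d}})
  lower : X ! * 4 ^ ℓ ≤ pow a ℓ X * r ^ X
  lower = begin
    X ! * 4 ^ ℓ                       ≤⟨ *-monoˡ-≤ (4 ^ ℓ) (pow-lowerBound a d 1≤a_d ℓ) ⟩
    pow a ℓ X * (d !) ^ ℓ * 4 ^ ℓ     ≡⟨ *-assoc (pow a ℓ X) ((d !) ^ ℓ) (4 ^ ℓ) ⟩
    pow a ℓ X * ((d !) ^ ℓ * 4 ^ ℓ)   ≡⟨ cong (pow a ℓ X *_) (trans (*-comm ((d !) ^ ℓ) (4 ^ ℓ)) (sym (^-distribʳ-* 4 (d !) ℓ))) ⟩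
    pow a ℓ X * r ^ ℓ                 ≤⟨ *-monoʳ-≤ (pow a ℓ X) r^ℓ≤r^X ⟩
    pow a ℓ X * r ^ X                 ∎
  upper : pow a ℓ X * r ^ X ≤ X ! * (ℓ * M)
  upper = begin
    pow a ℓ X * r ^ X                 ≤⟨ *-monoˡ-≤ (r ^ X) (pow≤u ℓ (s≤s z≤n)) ⟩
    (u X + 1) * ℓ * r ^ X             ≡⟨ spread (u X) ℓ (r ^ X) ⟩
    ℓ * (u X * r ^ X + r ^ X)         ≤⟨ *-monoʳ-≤ ℓ (+-mono-≤ (u≤B X) (m^n≤m^m*n! r X)) ⟩
    ℓ * (B * X ! + r ^ r * X !)       ≡⟨ collect ℓ B (X !) (r ^ r) ⟩
    X ! * (ℓ * M)                     ∎
    where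
    spread : ∀ u l x → (u + 1) * l * x ≡ l * (u * x + x)
    spread = solve-∀
    collect : ∀ l B g f → l * (B * g + f * g) ≡ g * (l * (B + f))
    collect = solve-∀

m≤[m/n+1]*n : ∀ m n .{{_ : NonZero n}} → m ≤ (m / n + 1) * n
m≤[m/n+1]*n m n = begin
  m                      ≡⟨ m≡m%n+[m/n]*n m n ⟩
  m % n + m / n * n      ≤⟨ +-monoˡ-≤ (m / n * n) (<⇒≤ (m%n<n m n)) ⟩
  n + m / n * n          ≡⟨ +-comm n (m / n * n) ⟩
  m / n * n + n          ≡⟨ cong (m / n * n +_) (sym (*-identityˡ n)) ⟩
  m / n * n + 1 * n      ≡⟨ sym (*-distribʳ-+ n (m / n) 1) ⟩
  (m / n + 1) * n        ∎

seqC-¬entire : ∀ (a : Counts) → a 0 ≡ 0 → Nonempty a → ¬ Entire (seqC a)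
seqC-¬entire a a₀≡0 (zero    , 1≤a₀) _ = <⇒≢ 1≤a₀ (sym a₀≡0)
seqC-¬entire a a₀≡0 (suc q , 1≤a_q) = powers≤⇒¬entire a (seqC a) (suc q) (s≤s z≤n) 1≤a_q pow≤seq
  where
  pow≤seq : ∀ ℓ → 1 ≤ ℓ → pow a ℓ (ℓ * suc q) ≤ (seqC a (ℓ * suc q) + 1) * ℓ
  pow≤seq ℓ 1≤ℓ = ≤-trans (term≤sumTo (ℓ * suc q) (λ t → pow a t (ℓ * suc q)) (m≤m*n ℓ (suc q)))
    (≤-trans (m≤m+n _ 1) (m≤m*n _ ℓ {{>-nonZero 1≤ℓ}}))

cycC-¬entire : ∀ (a : Counts) → a 0 ≡ 0 → Nonempty a → ¬ Entire (cycC a)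
cycC-¬entire a a₀≡0 (zero    , 1≤a₀) _ = <⇒≢ 1≤a₀ (sym a₀≡0)
cycC-¬entire a a₀≡0 (suc q , 1≤a_q) = powers≤⇒¬entire a (cycC a) (suc q) (s≤s z≤n) 1≤a_q pow≤cyc
  where
  pow≤cyc : ∀ ℓ → 1 ≤ ℓ → pow a ℓ (ℓ * suc q) ≤ (cycC a (ℓ * suc q) + 1) * ℓ
  pow≤cyc (suc l) _ = ≤-trans (m≤[m/n+1]*n (pow a (suc l) (suc l * suc q)) (suc l))
    (*-monoˡ-≤ (suc l) (+-monoˡ-≤ 1 (term≤sumTo (q + l * suc q) (λ t → pow a (suc t) (suc l * suc q) / suc t)
      (≤-trans (m≤m*n l (suc q)) (m≤n+m _ q)))))

hasSeqOrCyc⇒¬entire : ∀ {m} (e : Expr m) (y : Fin m → Counts) → (∀ j → Nonempty (y j)) →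
                      HasSeqOrCyc e → WellDefinedAt e y → ¬ Entire (eval e y)
hasSeqOrCyc⇒¬entire (Seq e)  y ne isSeq      (we , e₀) = seqC-¬entire (eval e y) e₀ (eval-nonempty e y ne we)
hasSeqOrCyc⇒¬entire (Cyc e)  y ne isCyc      (we , e₀) = cycC-¬entire (eval e y) e₀ (eval-nonempty e y ne we)
hasSeqOrCyc⇒¬entire (Seq e)  y ne (inSeq _)  wd        = hasSeqOrCyc⇒¬entire (Seq e) y ne isSeq wd
hasSeqOrCyc⇒¬entire (Cyc e)  y ne (inCyc _)  wd        = hasSeqOrCyc⇒¬entire (Cyc e) y ne isCyc wd
hasSeqOrCyc⇒¬entire (e ⊕ f)  y ne (⊕ˡ sc)   (we , _)  =
  hasSeqOrCyc⇒¬entire e y ne sc we ∘ ≤ᶜ-entire {eval e y} {eval (e ⊕ f) y} (λ n → m≤m+n _ _)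
hasSeqOrCyc⇒¬entire (e ⊕ f)  y ne (⊕ʳ sc)   (_ , wf)  =
  hasSeqOrCyc⇒¬entire f y ne sc wf ∘ ≤ᶜ-entire {eval f y} {eval (e ⊕ f) y} (λ n → m≤n+m _ _)
hasSeqOrCyc⇒¬entire (e ⊗ f)  y ne (⊗ˡ sc)   (we , wf) with eval-nonempty f y ne wf
... | q , 1≤f_q = hasSeqOrCyc⇒¬entire e y ne sc we ∘ Shift≤-entire (⋆-Shift≤ˡ {eval e y} {eval f y} q 1≤f_q)
hasSeqOrCyc⇒¬entire (e ⊗ f)  y ne (⊗ʳ sc)   (we , wf) with eval-nonempty e y ne we
... | q , 1≤e_q = hasSeqOrCyc⇒¬entire f y ne sc wf ∘ Shift≤-entire (⋆-Shift≤ˡ {eval f y} {eval e y} q 1≤e_q)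
                    ∘ Entire-resp-≗ {eval f y ⋆ eval e y} (⋆-comm (eval f y) (eval e y))
hasSeqOrCyc⇒¬entire (Set' e) y ne (inSet sc) (we , e₀) =
  hasSeqOrCyc⇒¬entire e y ne sc we ∘ ≤ᶜ-entire (≤setC (eval e y) e₀)

infix 4 _≺_

data _≺_ (a b : Counts) : Set where
  shifted : ∀ {d K} → 1 ≤ d → Shift≤ d K a b → a ≺ b

≺-trans : ∀ {a b c} → a ≺ b → b ≺ c → a ≺ c
≺-trans (shifted 1≤d a≤b) (shifted _ b≤c) = shifted (≤-trans 1≤d (m≤m+n _ _)) (Shift≤-trans a≤b b≤c)

≺-≤ᶜ : ∀ {a b c} → a ≺ b → b ≤ᶜ c → a ≺ c
≺-≤ᶜ {b = b} {c} (shifted 1≤d a≤b) b≤c =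
  shifted (≤-trans 1≤d (m≤m+n _ 0)) (Shift≤-trans a≤b (≤ᶜ⇒Shift≤ {b} {c} b≤c))

≤ᶜ-≺ : ∀ {a b c} → a ≤ᶜ b → b ≺ c → a ≺ c
≤ᶜ-≺ {a} {b} a≤b (shifted 1≤d b≤c) = shifted 1≤d (Shift≤-trans (≤ᶜ⇒Shift≤ {a} {b} a≤b) b≤c)

-- b dominates a after a positive shift, strictly at some size, or with no visible excess; in the
-- last case Exact records what is known about the approximations of a and b.
data Growth (a b : Counts) (Exact : Set) : Set where
  shift  : a ≺ b → Growth a b Exact
  strict : a ≤ᶜ b → (∃ λ q → a q < b q) → Growth a b Exact
  exact  : a ≤ᶜ b → Exact → Growth a b Exact

Growth-map : ∀ {a b b′ E E′} → (∀ n → b n ≡ b′ n) → (E → E′) → Growth a b E → Growth a b′ E′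
Growth-map b≗b′ f (shift (shifted 1≤d a≤b))  = shift (shifted 1≤d (Shift≤-respʳ b≗b′ a≤b))
Growth-map b≗b′ f (strict a≤b (q , aq<bq)) =
  strict (λ n → ≤-trans (a≤b n) (≤-reflexive (b≗b′ n))) (q , <-≤-trans aq<bq (≤-reflexive (b≗b′ q)))
Growth-map b≗b′ f (exact a≤b e)            = exact (λ n → ≤-trans (a≤b n) (≤-reflexive (b≗b′ n))) (f e)

Growth-≺ : ∀ {a b c E} → Growth a b E → b ≺ c → a ≺ c
Growth-≺ (shift a≺b)    b≺c = ≺-trans a≺b b≺c
Growth-≺ (strict a≤b _) b≺c = ≤ᶜ-≺ a≤b b≺c
Growth-≺ (exact a≤b _)  b≺c = ≤ᶜ-≺ a≤b b≺c

Growth-strictʳ : ∀ {a b c E E′} → Growth a b E → b ≤ᶜ c → (∃ λ q → b q < c q) → Growth a c E′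
Growth-strictʳ (shift a≺b)               b≤c _            = shift (≺-≤ᶜ a≺b b≤c)
Growth-strictʳ (strict a≤b (q , aq<bq)) b≤c _            = strict (≤ᶜ-trans a≤b b≤c) (q , <-≤-trans aq<bq (b≤c q))
Growth-strictʳ (exact a≤b _)             b≤c (q , bq<cq) = strict (≤ᶜ-trans a≤b b≤c) (q , ≤-<-trans (a≤b q) bq<cq)

Growth-compose : ∀ {a b c E₁ E₂ E} → Growth a b E₁ → Growth b c E₂ → (E₁ → E₂ → E) → Growth a c E
Growth-compose (shift a≺b)              (shift b≺c)              _ = shift (≺-trans a≺b b≺c)
Growth-compose (shift a≺b)              (strict b≤c _)           _ = shift (≺-≤ᶜ a≺b b≤c)
Growth-compose (shift a≺b)              (exact b≤c _)            _ = shift (≺-≤ᶜ a≺b b≤c)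
Growth-compose g                        (shift b≺c)              _ = shift (Growth-≺ g b≺c)
Growth-compose (strict a≤b (q , aq<bq)) (strict b≤c _)           _ = strict (≤ᶜ-trans a≤b b≤c) (q , <-≤-trans aq<bq (b≤c q))
Growth-compose (strict a≤b (q , aq<bq)) (exact b≤c _)            _ = strict (≤ᶜ-trans a≤b b≤c) (q , <-≤-trans aq<bq (b≤c q))
Growth-compose (exact a≤b _)            (strict b≤c (q , bq<cq)) _ = strict (≤ᶜ-trans a≤b b≤c) (q , ≤-<-trans (a≤b q) bq<cq)
Growth-compose (exact a≤b e₁)           (exact b≤c e₂)           f = exact (≤ᶜ-trans a≤b b≤c) (f e₁ e₂)

⋆-≤ᶜ-concentrated : ∀ {b c c′ : Counts} → c′ ≤ᶜ c → ConcentratedAt0 c → c 0 ≡ 1 → b ⋆ c′ ≤ᶜ b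
⋆-≤ᶜ-concentrated {b} {c} {c′} c′≤c c₊≡0 c₀≡1 n = begin
  (b ⋆ c′) n  ≤⟨ ⋆-mono {b} {b} (λ _ → ≤-refl) c′≤c n ⟩
  (b ⋆ c) n   ≡⟨ ⋆-concentratedʳ b c c₊≡0 n ⟩
  b n * c 0   ≡⟨ cong (b n *_) c₀≡1 ⟩
  b n * 1     ≡⟨ *-identityʳ (b n) ⟩
  b n         ∎

concentrated⇒1≤c₀ : ∀ {c} → ConcentratedAt0 c → Nonempty c → 1 ≤ c 0
concentrated⇒1≤c₀ c₊≡0 (zero  , 1≤c₀)  = 1≤c₀
concentrated⇒1≤c₀ c₊≡0 (suc q , 1≤c_q) = ⊥-elim (<⇒≢ 1≤c_q (sym (c₊≡0 (suc q) (s≤s z≤n))))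

-- Whether c has a structure of positive size is not decidable, hence the double negation.
⋆-growth : ∀ {a b c E E′} → Growth a b E → Nonempty b → Nonempty c →
           (E → ConcentratedAt0 c → c 0 ≡ 1 → E′) → ¬ ¬ Growth a (b ⋆ c) E′
⋆-growth {a} {b} {c} {E} {E′} g (p , 1≤b_p) ne-c exact′ = ¬¬-map byCases ¬¬-excluded-middle
  where
  concentrated : ConcentratedAt0 c → Growth a (b ⋆ c) E′
  concentrated c₊≡0 with c 0 ≟ 1
  ... | yes c₀≡1 = Growth-map b≗b⋆c (λ e → exact′ e c₊≡0 c₀≡1) g
    where
    b≗b⋆c : ∀ n → b n ≡ (b ⋆ c) n
    b≗b⋆c n = sym (trans (⋆-concentratedʳ b c c₊≡0 n) (trans (cong (b n *_) c₀≡1) (*-identityʳ (b n))))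
  ... | no c₀≢1 = Growth-strictʳ g b≤b⋆c (p , <-≤-trans b_p<b_p*c₀ (≤-reflexive (sym (⋆-concentratedʳ b c c₊≡0 p))))
    where
    1≤c₀ : 1 ≤ c 0
    1≤c₀ = concentrated⇒1≤c₀ c₊≡0 ne-c
    b≤b⋆c : b ≤ᶜ b ⋆ c
    b≤b⋆c n = ≤-trans (m≤m*n (b n) (c 0) {{>-nonZero 1≤c₀}}) (≤-reflexive (sym (⋆-concentratedʳ b c c₊≡0 n)))
    b_p<b_p*c₀ : b p < b p * c 0
    b_p<b_p*c₀ = ≤-<-trans (≤-reflexive (sym (*-identityʳ (b p))))
                           (*-monoʳ-< (b p) {{>-nonZero 1≤b_p}} (≤∧≢⇒< 1≤c₀ (c₀≢1 ∘ sym)))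
  byCases : Dec (∃ λ q → 1 ≤ q × 1 ≤ c q) → Growth a (b ⋆ c) E′
  byCases (yes (q , 1≤q , 1≤c_q)) = shift (Growth-≺ g (shifted 1≤q (⋆-Shift≤ˡ {b} {c} q 1≤c_q)))
  byCases (no ¬positive)           = concentrated c₊≡0
    where
    c₊≡0 : ConcentratedAt0 c
    c₊≡0 q 1≤q with c q ≟ 0
    ... | yes c_q≡0 = c_q≡0
    ... | no  c_q≢0 = ⊥-elim (¬positive (q , 1≤q , n≢0⇒n>0 c_q≢0))

-- Entire limits force an acyclic system free of Seq and Cyc

module EntireLimit {m : ℕ} (H : Spec m) (con : Constructive H) (s : Fin m → Counts) (lim : IsLimit H s)
                   (entire : ∀ i → Entire (s i)) where

  open Limit H s lim
  open RawMonad (¬¬-Monad {0ℓ}) using (pure; _>>=_)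

  limit-nonempty : ∀ j → Nonempty (s j)
  limit-nonempty j with proj₂ con
  ... | K , zeroFree with zeroFree j
  ... | n , iterₙ≢0 = n , ≤-trans (n≢0⇒n>0 iterₙ≢0) (iter≤limit K j n)

  wellDefined : ∀ i → WellDefinedAt (H i) s
  wellDefined = limit-wellDefined (proj₁ con)

  ¬containsSeqOrCyc : ¬ ContainsSeqOrCyc H
  ¬containsSeqOrCyc (i , sc) = hasSeqOrCyc⇒¬entire (H i) s limit-nonempty sc (wellDefined i)
    (Entire-resp-≗ {eval (H i) s} (λ n → sym (limit-isFixpoint i n)) (entire i))

  nonempty : ∀ e → WellDefinedAt e s → Nonempty (eval e s)
  nonempty e = eval-nonempty e s limit-nonempty

  OccurrenceGrowth : Fin m → Expr m → Set
  OccurrenceGrowth j e = Growth (s j) (eval e s) (∀ k → eval e (iter H k) ≤ᶜ iter H k j)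

  occurrence-growth : ∀ {j} e → Occurs j e → ¬ HasSeqOrCyc e → WellDefinedAt e s → ¬ ¬ OccurrenceGrowth j e
  occurrence-growth (var j)  here      _   _         = pure (exact (λ _ → ≤-refl) (λ _ _ → ≤-refl))
  occurrence-growth (e ⊕ f)  (⊕ˡ occ) ¬sc (we , wf) = do
    g ← occurrence-growth e occ (¬sc ∘ ⊕ˡ) we
    let q , 1≤f_q = nonempty f wf
    pure (Growth-strictʳ g (λ n → m≤m+n _ _) (q , m<m+n _ 1≤f_q))
  occurrence-growth (e ⊕ f)  (⊕ʳ occ) ¬sc (we , wf) = do
    g ← occurrence-growth f occ (¬sc ∘ ⊕ʳ) wf
    let q , 1≤e_q = nonempty e we
    pure (Growth-strictʳ g (λ n → m≤n+m _ _) (q , m<n+m _ 1≤e_q))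
  occurrence-growth (e ⊗ f)  (⊗ˡ occ) ¬sc (we , wf) = do
    g ← occurrence-growth e occ (¬sc ∘ ⊗ˡ) we
    ⋆-growth g (nonempty e we) (nonempty f wf) λ e≤ f₊≡0 f₀≡1 k →
      ≤ᶜ-trans (⋆-≤ᶜ-concentrated (eval-mono f (iter≤limit k)) f₊≡0 f₀≡1) (e≤ k)
  occurrence-growth (e ⊗ f)  (⊗ʳ occ) ¬sc (we , wf) = do
    g ← occurrence-growth f occ (¬sc ∘ ⊗ʳ) wf
    g′ ← ⋆-growth g (nonempty f wf) (nonempty e we) λ f≤ e₊≡0 e₀≡1 k n →
      ≤-trans (≤-reflexive (⋆-comm (eval e (iter H k)) (eval f (iter H k)) n))
        (≤ᶜ-trans (⋆-≤ᶜ-concentrated (eval-mono e (iter≤limit k)) e₊≡0 e₀≡1) (f≤ k) n)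
    pure (Growth-map (⋆-comm (eval f s) (eval e s)) id g′)
  occurrence-growth (Seq e)  (inSeq _) ¬sc _         = ⊥-elim (¬sc isSeq)
  occurrence-growth (Cyc e)  (inCyc _) ¬sc _         = ⊥-elim (¬sc isCyc)
  occurrence-growth (Set' e) (inSet occ) ¬sc (we , e₀) = do
    g ← occurrence-growth e occ (¬sc ∘ inSet) we
    pure (Growth-strictʳ g (≤setC (eval e s) e₀) (0 , ≤-reflexive (cong suc e₀)))

  LagsBehind : Fin m → Fin m → Set
  LagsBehind x y = ∃ λ L → 1 ≤ L × ∀ k → iter H (L + k) x ≤ᶜ iter H k y

  EdgeGrowth : Fin m → Fin m → Set
  EdgeGrowth y x = Growth (s y) (s x) (LagsBehind x y)

  edge-growth : ∀ {x y} → Edge H x y → ¬ ¬ EdgeGrowth y x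
  edge-growth {x} x→y = do
    g ← occurrence-growth (H x) x→y (λ sc → ¬containsSeqOrCyc (x , sc)) (wellDefined x)
    pure (Growth-map (λ n → sym (limit-isFixpoint x n)) (λ ex → 1 , ≤-refl , ex) g)

  path-growth : ∀ {x z} → TransClosure (Edge H) x z → ¬ ¬ EdgeGrowth z x
  path-growth [ x→z ]       = edge-growth x→z
  path-growth (x→y ∷ y→⁺z) = do
    g₂ ← path-growth y→⁺z
    g₁ ← edge-growth x→y
    pure (Growth-compose g₂ g₁ exact-compose)
    where
    exact-compose : ∀ {x y z} → LagsBehind y z → LagsBehind x y → LagsBehind x z
    exact-compose {x} (L₁ , 1≤L₁ , y≤z) (L₂ , _ , x≤y) = L₂ + L₁ , ≤-trans 1≤L₁ (m≤n+m L₁ L₂) , λ k n →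
      ≤-trans (≤-reflexive (cong (λ t → iter H t x n) (+-assoc L₂ L₁ k))) (≤-trans (x≤y (L₁ + k) n) (y≤z k n))

  ¬cycle-growth : ∀ i → ¬ EdgeGrowth i i
  ¬cycle-growth i (shift (shifted 1≤d sᵢ≤sᵢ)) = Shift≤-self⇒¬entire sᵢ≤sᵢ 1≤d (limit-nonempty i) (entire i)
  ¬cycle-growth i (strict _ (q , sq<sq))     = <-irrefl refl sq<sq
  ¬cycle-growth i (exact _ (L , 1≤L , descend)) with proj₂ con
  ... | K , zeroFree with zeroFree i
  ... | n , iterₙ≢0 =
    iterₙ≢0 (n≤0⇒n≡0 (≤-trans (iter-mono (m≤m*n K L {{>-nonZero 1≤L}}) i n) (≤-reflexive (vanish K))))
    where
    vanish : ∀ c → iter H (c * L) i n ≡ 0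
    vanish zero    = refl
    vanish (suc c) = n≤0⇒n≡0 (≤-trans (descend (c * L) n) (≤-reflexive (vanish c)))

  ¬recursive : ¬ Recursive H
  ¬recursive (i , cycle) = path-growth cycle (¬cycle-growth i)

proposition3p12 : ∀ {m : ℕ} (H : Spec m) → Constructive H →
    (s : Fin m → Counts) → IsLimit H s →
    ((∀ i → InfiniteRadius (s i)) ⇔ (¬ Recursive H × ¬ ContainsSeqOrCyc H))
proposition3p12 H con s lim = mk⇔ onlyIf if
  where
  onlyIf : (∀ i → InfiniteRadius (s i)) → ¬ Recursive H × ¬ ContainsSeqOrCyc H
  onlyIf infinite = ¬recursive , ¬containsSeqOrCyc
    where open EntireLimit H con s lim (λ i → infiniteRadius⇒entire (s i) (infinite i))
  if : ¬ Recursive H × ¬ ContainsSeqOrCyc H → ∀ i → InfiniteRadius (s i)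
  if (¬rec , ¬sc) i = entire⇒infiniteRadius (s i) (nonRecursive⇒limit-entire H (proj₁ con) s lim ¬rec ¬sc i)
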